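{- For each $n\ge 0$, \[ C^{\circ}_n(t)=\frac{1}{n!}\sum_{k=0}^n(-1)^{n-k}{n\brack k}\,\mathrm{fub}(k)\sum_{i=0}^k{k\brace i}\,i!\,(t-1)^{n-i}. \]
   Context: A Cayley permutation of $[n]=\{1,\dots,n\}$ is a word $w=w(1)\cdots w(n)$ of positive integers whose set of values is $\{1,\dots,k\}$ for some $k\le n$; $\mathrm{Cay}[n]$ is the set of these. Let $\mathrm{des}^{\circ}(w)=|\{i\in[n-1]:w(i)>w(i+1)\}|$ and $C^{\circ}_n(t)=\sum_{w\in\mathrm{Cay}[n]}t^{\mathrm{des}^{\circ}(w)}$ (the strict Caylerian polynomial). ${n\brack k}$ is the unsigned Stirling number of the first kind, ${k\brace i}$ the Stirling number of the second kind, and $\mathrm{fub}(k)$ the number of ordered set partitions of $[k]$ ($\mathrm{fub}(0)=1$). -}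

module Defs where

open import Data.Nat as ℕ using (ℕ; zero; suc; _≤ᵇ_; _<ᵇ_; _≡ᵇ_; _!)
open import Data.Integer as ℤ using (ℤ; +_; -_)
open import Data.List using (List; []; _∷_; map; concatMap; filter; length; sum; upTo; foldr)
open import Data.Bool using (Bool; true; false; _∧_; _∨_; if_then_else_)
open import Relation.Binary.PropositionalEquality using (_≡_)
open import Relation.Nullary.Decidable using (Dec)
open import Data.Bool.Properties using () renaming (_≟_ to _≟ᵇ_)

words : ℕ → ℕ → List (List ℕ)
words n zero    = [] ∷ []
words n (suc m) = concatMap (λ w → map (λ a → suc a ∷ w) (upTo n)) (words n m)

anyB : {A : Set} → (A → Bool) → List A → Bool
anyB p = foldr (λ x b → p x ∨ b) false

allB : {A : Set} → (A → Bool) → List A → Bool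
allB p = foldr (λ x b → p x ∧ b) true

maxL : List ℕ → ℕ
maxL = foldr ℕ._⊔_ 0

occurs : ℕ → List ℕ → Bool
occurs v w = anyB (λ x → x ≡ᵇ v) w

-- value set of w is {1,…,k} for some k: all letters positive, and every
-- v with 1 ≤ v ≤ max w occurs in w
isCayley : List ℕ → Bool
isCayley w = allB (λ x → 1 ≤ᵇ x) w ∧ allB (λ v → occurs (suc v) w) (upTo (maxL w))

Cay : ℕ → List (List ℕ)
Cay n = filter (λ w → isCayley w ≟ᵇ true) (words n n)

des : List ℕ → ℕ
des []           = 0
des (x ∷ [])     = 0
des (x ∷ y ∷ w)  = (if y <ᵇ x then 1 else 0) ℕ.+ des (y ∷ w)

-- Polynomials in t with integer coefficients, as coefficient lists
-- (constant term first).

Poly : Set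
Poly = List ℤ

coeff : Poly → ℕ → ℤ
coeff []       _       = + 0
coeff (a ∷ p)  zero    = a
coeff (a ∷ p)  (suc j) = coeff p j

_⊕_ : Poly → Poly → Poly
[]      ⊕ q       = q
(a ∷ p) ⊕ []      = a ∷ p
(a ∷ p) ⊕ (b ∷ q) = (a ℤ.+ b) ∷ (p ⊕ q)

scale : ℤ → Poly → Poly
scale c = map (c ℤ.*_)

_⊗_ : Poly → Poly → Poly
[]      ⊗ q = []
(a ∷ p) ⊗ q = scale a q ⊕ (+ 0 ∷ (p ⊗ q))

_^ₚ_ : Poly → ℕ → Poly
p ^ₚ zero  = + 1 ∷ []
p ^ₚ suc m = p ⊗ (p ^ₚ m)

tpow : ℕ → Poly
tpow zero    = + 1 ∷ []
tpow (suc j) = + 0 ∷ tpow j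

tMinus1 : Poly
tMinus1 = - (+ 1) ∷ + 1 ∷ []

ΣP : ℕ → (ℕ → Poly) → Poly
ΣP zero    f = f 0
ΣP (suc n) f = ΣP n f ⊕ f (suc n)

Ccirc : ℕ → Poly
Ccirc n = foldr (λ w acc → tpow (des w) ⊕ acc) [] (Cay n)

stirling1 : ℕ → ℕ → ℕ
stirling1 zero    zero    = 1
stirling1 zero    (suc k) = 0
stirling1 (suc n) zero    = 0
stirling1 (suc n) (suc k) = n ℕ.* stirling1 n (suc k) ℕ.+ stirling1 n k

stirling2 : ℕ → ℕ → ℕ
stirling2 zero    zero    = 1
stirling2 zero    (suc k) = 0
stirling2 (suc n) zero    = 0
stirling2 (suc n) (suc k) = suc k ℕ.* stirling2 n (suc k) ℕ.+ stirling2 n k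

Σℕ : ℕ → (ℕ → ℕ) → ℕ
Σℕ zero    f = f 0
Σℕ (suc n) f = Σℕ n f ℕ.+ f (suc n)

-- fub(k) = number of ordered set partitions of [k]
--        = Σ_i (number of partitions into i blocks) · (orderings of the i blocks)
fub : ℕ → ℕ
fub k = Σℕ k (λ i → stirling2 k i ℕ.* (i !))

sgn : ℕ → ℤ
sgn zero    = + 1
sgn (suc m) = - sgn m

-- The right-hand side times n! :
-- Σ_{k=0}^n (-1)^{n-k} [n k] fub(k) Σ_{i=0}^k {k i} i! (t-1)^{n-i}
rhsTimesFact : ℕ → Poly
rhsTimesFact n =
  ΣP n (λ k → scale (sgn (n ℕ.∸ k) ℤ.* (+ (stirling1 n k ℕ.* fub k)))
    (ΣP k (λ i → scale (+ (stirling2 k i ℕ.* (i !))) (tMinus1 ^ₚ (n ℕ.∸ i)))))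

-- Both sides are expanded in powers of t − 1. Since t^d = Σ_e C(d,e) (t − 1)^e, the coefficient
-- of (t − 1)^(n−i) on the left is n! Σ_{w ∈ Cay[n]} C(des w, n − i); on the right it is
-- Σ_k s(n,k) fub(k) S(k,i) i!, where s(n,k) = (−1)^(n−k) [n k]. Two sequences indexed by i ≤ n
-- agree as soon as their binomial transforms r ↦ Σ_i C(r,i) a_i agree for every r.
-- On the right, r^k = Σ_i C(r,i) S(k,i) i! (maps [k] → [r] counted by their image) turns the
-- transform into Σ_k s(n,k) fub(k) r^k. On the left, Vandermonde gives n! Σ_{w ∈ Cay[n]} C(r + des w, n).
-- Inclusion–exclusion over the letters missing from a word reduces Cayley permutations to all
-- words over [b], for which Σ_{w ∈ [b]^n} C(r + des w, n) = C(rb, n). Expanding n! C(rb, n) in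
-- powers of rb by Stirling numbers of the first kind and evaluating the alternating sums
-- Σ_j (−1)^j C(k,j) (k − j)^q = S(q,k) k! gives Σ_k s(n,k) fub(k) r^k again.

module Submission where

open import Defs
open import Data.Nat as ℕ using (ℕ; zero; suc; _!; z≤n; s≤s; _<ᵇ_; _≤ᵇ_; _≡ᵇ_)
open import Data.Nat.Induction using (<-rec)
open import Data.Nat.Combinatorics using (_C_; nCn≡1; nC1≡n; k>n⇒nCk≡0; nCk+nC[k+1]≡[n+1]C[k+1])
import Data.Nat.Properties as ℕ
open import Data.Integer using (ℤ; +_; -_; _+_; _-_; _*_; _^_; 0ℤ; 1ℤ)
open import Data.Integer.Properties
open import Algebra.Properties.AbelianGroup +-0-abelianGroup using (∙-cancelˡ)
open import Data.Integer.Tactic.RingSolver using (solve-∀)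
open import Data.Nat.Tactic.RingSolver using () renaming (solve-∀ to ℕ-solve-∀)
open import Data.Product using (_×_; _,_; proj₂)
open import Data.List using (List; []; _∷_; _++_; map; concatMap; foldr; filter; filterᵇ; upTo; applyUpTo; length)
open import Data.Bool using (Bool; true; false; _∧_; _∨_; not; if_then_else_; T)
open import Data.Bool.Properties using (∧-assoc; ∧-identityʳ; ∧-zeroʳ; T-≡) renaming (_≟_ to _≟ᵇ_)
open import Data.List.Relation.Unary.All as All using (All; []; _∷_)
import Data.List.Relation.Unary.All.Properties as Allₚ
open import Data.List.Properties
  using (map-∘; concatMap-cong; map-id-local; map-++; applyUpTo-∷ʳ; ++-identityʳ; filter-++; filter-all; filter-accept; filter-reject)
open import Function using (_∘_)
open import Function.Bundles using (Equivalence)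
open import Relation.Binary.PropositionalEquality
open import Relation.Nullary using (yes; no; does; contradiction)
open import Relation.Nullary.Decidable using (T?)
open import Relation.Binary.Definitions using (tri<; tri≈; tri>)
open import Relation.Unary using (Decidable)

open ≡-Reasoning

private variable A B : Set

<ᵇ≡true : ∀ {a x} → a ℕ.< x → (a <ᵇ x) ≡ true
<ᵇ≡true a<x = Equivalence.to T-≡ (ℕ.<⇒<ᵇ a<x)

<ᵇ≡false : ∀ {a x} → x ℕ.≤ a → (a <ᵇ x) ≡ false
<ᵇ≡false {a}     {zero}  _         = refl
<ᵇ≡false {suc a} {suc x} (s≤s x≤a) = <ᵇ≡false x≤a

≤ᵇ≡true : ∀ {x k} → x ℕ.≤ k → (x ≤ᵇ k) ≡ true
≤ᵇ≡true x≤k = Equivalence.to T-≡ (ℕ.≤⇒≤ᵇ x≤k)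

≤ᵇ≡false : ∀ {x k} → k ℕ.< x → (x ≤ᵇ k) ≡ false
≤ᵇ≡false {suc x} (s≤s k≤x) = <ᵇ≡false k≤x

≡ᵇ≡false : ∀ {x y} → x ≢ y → (x ≡ᵇ y) ≡ false
≡ᵇ≡false {x} {y} x≢y with x ≡ᵇ y in x≡ᵇy
... | true  = contradiction (ℕ.≡ᵇ⇒≡ x y (Equivalence.from T-≡ x≡ᵇy)) x≢y
... | false = refl

≡ᵇ-refl : ∀ x → (x ≡ᵇ x) ≡ true
≡ᵇ-refl x = Equivalence.to T-≡ (ℕ.≡⇒≡ᵇ x x refl)

∑ : ℕ → (ℕ → ℤ) → ℤ
∑ zero    f = 0ℤ
∑ (suc n) f = ∑ n f + f n

∑-cong-< : ∀ n {f g : ℕ → ℤ} → (∀ i → i ℕ.< n → f i ≡ g i) → ∑ n f ≡ ∑ n g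
∑-cong-< zero    eq = refl
∑-cong-< (suc n) eq = cong₂ _+_ (∑-cong-< n (λ i i<n → eq i (ℕ.m<n⇒m<1+n i<n))) (eq n ℕ.≤-refl)

∑-cong : ∀ n {f g : ℕ → ℤ} → (∀ i → f i ≡ g i) → ∑ n f ≡ ∑ n g
∑-cong n eq = ∑-cong-< n (λ i _ → eq i)

∑-zero : ∀ n {f : ℕ → ℤ} → (∀ i → i ℕ.< n → f i ≡ 0ℤ) → ∑ n f ≡ 0ℤ
∑-zero zero    eq = refl
∑-zero (suc n) eq =
  cong₂ _+_ (∑-zero n (λ i i<n → eq i (ℕ.m<n⇒m<1+n i<n))) (eq n ℕ.≤-refl)

∑-0 : ∀ n → ∑ n (λ _ → 0ℤ) ≡ 0ℤ
∑-0 n = ∑-zero n (λ _ _ → refl)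

∑-+ : ∀ n (f g : ℕ → ℤ) → ∑ n (λ i → f i + g i) ≡ ∑ n f + ∑ n g
∑-+ zero    f g = refl
∑-+ (suc n) f g = trans (cong (_+ (f n + g n)) (∑-+ n f g)) (swap (∑ n f) (∑ n g) (f n) (g n))
  where swap : ∀ a b c d → a + b + (c + d) ≡ a + c + (b + d)
        swap = solve-∀

∑-- : ∀ n (f g : ℕ → ℤ) → ∑ n (λ i → f i - g i) ≡ ∑ n f - ∑ n g
∑-- zero    f g = refl
∑-- (suc n) f g = trans (cong (_+ (f n - g n)) (∑-- n f g)) (swap (∑ n f) (∑ n g) (f n) (g n))
  where swap : ∀ a b c d → a - b + (c - d) ≡ a + c - (b + d)
        swap = solve-∀

∑-*ˡ : ∀ n (c : ℤ) (f : ℕ → ℤ) → ∑ n (λ i → c * f i) ≡ c * ∑ n f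
∑-*ˡ zero    c f = sym (*-zeroʳ c)
∑-*ˡ (suc n) c f = trans (cong (_+ c * f n) (∑-*ˡ n c f)) (sym (*-distribˡ-+ c (∑ n f) (f n)))

∑-*ʳ : ∀ n (c : ℤ) (f : ℕ → ℤ) → ∑ n (λ i → f i * c) ≡ ∑ n f * c
∑-*ʳ n c f = begin
  ∑ n (λ i → f i * c)  ≡⟨ ∑-cong n (λ i → *-comm (f i) c) ⟩
  ∑ n (λ i → c * f i)  ≡⟨ ∑-*ˡ n c f ⟩
  c * ∑ n f            ≡⟨ *-comm c (∑ n f) ⟩
  ∑ n f * c            ∎

∑-swap : ∀ n m (f : ℕ → ℕ → ℤ) → ∑ n (λ i → ∑ m (f i)) ≡ ∑ m (λ j → ∑ n (λ i → f i j))
∑-swap zero    m f = sym (∑-0 m)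
∑-swap (suc n) m f = begin
  ∑ n (λ i → ∑ m (f i)) + ∑ m (f n)              ≡⟨ cong (_+ ∑ m (f n)) (∑-swap n m f) ⟩
  ∑ m (λ j → ∑ n (λ i → f i j)) + ∑ m (f n)      ≡⟨ ∑-+ m (λ j → ∑ n (λ i → f i j)) (f n) ⟨
  ∑ m (λ j → ∑ n (λ i → f i j) + f n j)          ∎

∑-first : ∀ n (f : ℕ → ℤ) → ∑ (suc n) f ≡ f 0 + ∑ n (f ∘ suc)
∑-first zero    f = +-comm 0ℤ (f 0)
∑-first (suc n) f = trans (cong (_+ f (suc n)) (∑-first n f)) (+-assoc (f 0) (∑ n (f ∘ suc)) (f (suc n)))

∑-shift : ∀ n (f : ℕ → ℤ) → f n ≡ 0ℤ → ∑ n (f ∘ suc) ≡ ∑ n f - f 0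
∑-shift n f fn≡0 = begin
  ∑ n (f ∘ suc)                  ≡⟨ add-sub (∑ n (f ∘ suc)) (f 0) ⟩
  f 0 + ∑ n (f ∘ suc) - f 0      ≡⟨ cong (_- f 0) (∑-first n f) ⟨
  ∑ n f + f n - f 0              ≡⟨ cong (λ x → ∑ n f + x - f 0) fn≡0 ⟩
  ∑ n f + 0ℤ - f 0               ≡⟨ cong (_- f 0) (+-identityʳ (∑ n f)) ⟩
  ∑ n f - f 0                    ∎
  where add-sub : ∀ a b → a ≡ b + a - b
        add-sub = solve-∀

∑-split : ∀ m n (f : ℕ → ℤ) → ∑ (m ℕ.+ n) f ≡ ∑ m f + ∑ n (λ i → f (m ℕ.+ i))
∑-split m zero    f rewrite ℕ.+-identityʳ m = sym (+-identityʳ (∑ m f))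
∑-split m (suc n) f rewrite ℕ.+-suc m n =
  trans (cong (_+ f (m ℕ.+ n)) (∑-split m n f)) (+-assoc (∑ m f) (∑ n (λ i → f (m ℕ.+ i))) (f (m ℕ.+ n)))

∑-extend : ∀ m n {f : ℕ → ℤ} → m ℕ.≤ n → (∀ i → m ℕ.≤ i → f i ≡ 0ℤ) → ∑ n f ≡ ∑ m f
∑-extend m n {f} m≤n vanish with ℕ.m≤n⇒∃[o]m+o≡n m≤n
... | o , refl = begin
  ∑ (m ℕ.+ o) f                     ≡⟨ ∑-split m o f ⟩
  ∑ m f + ∑ o (λ i → f (m ℕ.+ i))   ≡⟨ cong (λ x → ∑ m f + x) (∑-zero o (λ i _ → vanish (m ℕ.+ i) (ℕ.m≤m+n m i))) ⟩
  ∑ m f + 0ℤ                        ≡⟨ +-identityʳ (∑ m f) ⟩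
  ∑ m f                             ∎

∑-single : ∀ n k {f : ℕ → ℤ} → k ℕ.< n → (∀ i → i ≢ k → f i ≡ 0ℤ) → ∑ n f ≡ f k
∑-single (suc n) k {f} k<1+n others with k ℕ.≟ n
... | yes refl = begin
  ∑ k f + f k   ≡⟨ cong (_+ f k) (∑-zero k (λ i i<k → others i (ℕ.<⇒≢ i<k))) ⟩
  0ℤ + f k      ≡⟨ +-identityˡ (f k) ⟩
  f k           ∎
... | no k≢n = begin
  ∑ n f + f n   ≡⟨ cong₂ _+_ (∑-single n k (ℕ.≤∧≢⇒< (ℕ.≤-pred k<1+n) k≢n) others) (others n (k≢n ∘ sym)) ⟩
  f k + 0ℤ      ≡⟨ +-identityʳ (f k) ⟩
  f k           ∎

∑-reverse : ∀ n (f : ℕ → ℤ) → ∑ n (λ i → f (n ℕ.∸ suc i)) ≡ ∑ n f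
∑-reverse zero    f = refl
∑-reverse (suc n) f = begin
  ∑ (suc n) (λ i → f (suc n ℕ.∸ suc i))   ≡⟨ ∑-first n _ ⟩
  f n + ∑ n (λ i → f (n ℕ.∸ suc i))       ≡⟨ cong (λ x → f n + x) (∑-reverse n f) ⟩
  f n + ∑ n f                             ≡⟨ +-comm (f n) (∑ n f) ⟩
  ∑ n f + f n                             ∎

∑-blocks : ∀ σ b (h : ℕ → ℤ) → ∑ σ (λ τ → ∑ b (λ a → h (τ ℕ.* b ℕ.+ a))) ≡ ∑ (σ ℕ.* b) h
∑-blocks zero    b h = refl
∑-blocks (suc σ) b h = begin
  ∑ σ (λ τ → ∑ b (λ a → h (τ ℕ.* b ℕ.+ a))) + ∑ b (λ a → h (σ ℕ.* b ℕ.+ a))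
    ≡⟨ cong (_+ ∑ b (λ a → h (σ ℕ.* b ℕ.+ a))) (∑-blocks σ b h) ⟩
  ∑ (σ ℕ.* b) h + ∑ b (λ a → h (σ ℕ.* b ℕ.+ a))
    ≡⟨ ∑-split (σ ℕ.* b) b h ⟨
  ∑ (σ ℕ.* b ℕ.+ b) h
    ≡⟨ cong (λ N → ∑ N h) (ℕ.+-comm (σ ℕ.* b) b) ⟩
  ∑ (b ℕ.+ σ ℕ.* b) h
    ∎

-- Every N < σ b + x is uniquely τ b + a with a < b, and τ = σ occurs exactly for a < x.
∑-interleave : ∀ σ x b (h : ℕ → ℤ) → x ℕ.≤ b →
  ∑ b (λ a → ∑ (σ ℕ.+ (if a <ᵇ x then 1 else 0)) (λ τ → h (τ ℕ.* b ℕ.+ a))) ≡ ∑ (σ ℕ.* b ℕ.+ x) h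
∑-interleave σ x b h x≤b = begin
  ∑ b (λ a → ∑ (σ ℕ.+ (if a <ᵇ x then 1 else 0)) (λ τ → h (τ ℕ.* b ℕ.+ a)))
    ≡⟨ ∑-cong b (λ a → trans (∑-split σ _ _) (cong (λ s → ∑ σ (λ τ → h (τ ℕ.* b ℕ.+ a)) + s) (extra a))) ⟩
  ∑ b (λ a → ∑ σ (λ τ → h (τ ℕ.* b ℕ.+ a)) + last a)
    ≡⟨ ∑-+ b _ last ⟩
  ∑ b (λ a → ∑ σ (λ τ → h (τ ℕ.* b ℕ.+ a))) + ∑ b last
    ≡⟨ cong₂ _+_ (trans (∑-swap b σ _) (∑-blocks σ b h))
                 (trans (∑-extend x b x≤b (λ a x≤a → last-vanish x≤a)) (∑-cong-< x (λ a a<x → last-below a<x))) ⟩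
  ∑ (σ ℕ.* b) h + ∑ x (λ a → h (σ ℕ.* b ℕ.+ a))
    ≡⟨ ∑-split (σ ℕ.* b) x h ⟨
  ∑ (σ ℕ.* b ℕ.+ x) h
    ∎
  where
  last : ℕ → ℤ
  last a = if a <ᵇ x then h (σ ℕ.* b ℕ.+ a) else 0ℤ
  extra : ∀ a → ∑ (if a <ᵇ x then 1 else 0) (λ i → h ((σ ℕ.+ i) ℕ.* b ℕ.+ a)) ≡ last a
  extra a with a <ᵇ x
  ... | true  = trans (+-identityˡ _) (cong (λ τ → h (τ ℕ.* b ℕ.+ a)) (ℕ.+-identityʳ σ))
  ... | false = refl
  last-vanish : ∀ {a} → x ℕ.≤ a → last a ≡ 0ℤ
  last-vanish x≤a rewrite <ᵇ≡false x≤a = refl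
  last-below : ∀ {a} → a ℕ.< x → last a ≡ h (σ ℕ.* b ℕ.+ a)
  last-below a<x rewrite <ᵇ≡true a<x = refl

∑ₗ : List A → (A → ℤ) → ℤ
∑ₗ []       f = 0ℤ
∑ₗ (x ∷ xs) f = f x + ∑ₗ xs f

∑ₗ-cong-All : ∀ {P : A → Set} {xs} {f g : A → ℤ} → All P xs → (∀ x → P x → f x ≡ g x) → ∑ₗ xs f ≡ ∑ₗ xs g
∑ₗ-cong-All []         eq = refl
∑ₗ-cong-All (px ∷ pxs) eq = cong₂ _+_ (eq _ px) (∑ₗ-cong-All pxs eq)

∑ₗ-cong : ∀ xs {f g : A → ℤ} → (∀ x → f x ≡ g x) → ∑ₗ xs f ≡ ∑ₗ xs g
∑ₗ-cong []       eq = refl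
∑ₗ-cong (x ∷ xs) eq = cong₂ _+_ (eq x) (∑ₗ-cong xs eq)

∑ₗ-++ : ∀ xs ys (f : A → ℤ) → ∑ₗ (xs ++ ys) f ≡ ∑ₗ xs f + ∑ₗ ys f
∑ₗ-++ []       ys f = sym (+-identityˡ (∑ₗ ys f))
∑ₗ-++ (x ∷ xs) ys f = trans (cong (λ s → f x + s) (∑ₗ-++ xs ys f)) (sym (+-assoc (f x) (∑ₗ xs f) (∑ₗ ys f)))

∑ₗ-concatMap : ∀ (g : A → List B) xs (f : B → ℤ) → ∑ₗ (concatMap g xs) f ≡ ∑ₗ xs (λ x → ∑ₗ (g x) f)
∑ₗ-concatMap g []       f = refl
∑ₗ-concatMap g (x ∷ xs) f = trans (∑ₗ-++ (g x) (concatMap g xs) f) (cong (λ s → ∑ₗ (g x) f + s) (∑ₗ-concatMap g xs f))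

∑ₗ-+ : ∀ xs (f g : A → ℤ) → ∑ₗ xs (λ x → f x + g x) ≡ ∑ₗ xs f + ∑ₗ xs g
∑ₗ-+ []       f g = refl
∑ₗ-+ (x ∷ xs) f g = trans (cong (λ s → f x + g x + s) (∑ₗ-+ xs f g)) (swap (f x) (g x) (∑ₗ xs f) (∑ₗ xs g))
  where swap : ∀ a b c d → a + b + (c + d) ≡ a + c + (b + d)
        swap = solve-∀

∑ₗ-*ˡ : ∀ xs (c : ℤ) (f : A → ℤ) → ∑ₗ xs (λ x → c * f x) ≡ c * ∑ₗ xs f
∑ₗ-*ˡ []       c f = sym (*-zeroʳ c)
∑ₗ-*ˡ (x ∷ xs) c f = trans (cong (λ s → c * f x + s) (∑ₗ-*ˡ xs c f)) (sym (*-distribˡ-+ c (f x) (∑ₗ xs f)))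

∑ₗ-*ʳ : ∀ xs (c : ℤ) (f : A → ℤ) → ∑ₗ xs (λ x → f x * c) ≡ ∑ₗ xs f * c
∑ₗ-*ʳ xs c f = begin
  ∑ₗ xs (λ x → f x * c)   ≡⟨ ∑ₗ-cong xs (λ x → *-comm (f x) c) ⟩
  ∑ₗ xs (λ x → c * f x)   ≡⟨ ∑ₗ-*ˡ xs c f ⟩
  c * ∑ₗ xs f             ≡⟨ *-comm c (∑ₗ xs f) ⟩
  ∑ₗ xs f * c             ∎

∑ₗ-∑ : ∀ xs n (f : A → ℕ → ℤ) → ∑ₗ xs (λ x → ∑ n (f x)) ≡ ∑ n (λ i → ∑ₗ xs (λ x → f x i))
∑ₗ-∑ []       n f = sym (∑-0 n)
∑ₗ-∑ (x ∷ xs) n f = trans (cong (λ s → ∑ n (f x) + s) (∑ₗ-∑ xs n f)) (sym (∑-+ n (f x) (λ i → ∑ₗ xs (λ y → f y i))))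

∑ₗ-map : ∀ (g : A → B) xs (f : B → ℤ) → ∑ₗ (map g xs) f ≡ ∑ₗ xs (f ∘ g)
∑ₗ-map g []       f = refl
∑ₗ-map g (x ∷ xs) f = cong (λ s → f (g x) + s) (∑ₗ-map g xs f)

∑ₗ-applyUpTo : ∀ (g : ℕ → ℕ) n (f : ℕ → ℤ) → ∑ₗ (applyUpTo g n) f ≡ ∑ n (f ∘ g)
∑ₗ-applyUpTo g zero    f = refl
∑ₗ-applyUpTo g (suc n) f = trans (cong (λ s → f (g 0) + s) (∑ₗ-applyUpTo (g ∘ suc) n f)) (sym (∑-first n (f ∘ g)))

⟦_⟧ : Bool → ℤ
⟦ true  ⟧ = 1ℤ
⟦ false ⟧ = 0ℤ

⟦∧⟧ : ∀ a b → ⟦ a ∧ b ⟧ ≡ ⟦ a ⟧ * ⟦ b ⟧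
⟦∧⟧ true  b = sym (*-identityˡ ⟦ b ⟧)
⟦∧⟧ false b = refl

∑ₗ-filter : ∀ {P : A → Set} (P? : Decidable P) xs (f : A → ℤ) → ∑ₗ (filter P? xs) f ≡ ∑ₗ xs (λ x → ⟦ does (P? x) ⟧ * f x)
∑ₗ-filter P? []       f = refl
∑ₗ-filter P? (x ∷ xs) f with does (P? x)
... | true  = cong₂ _+_ (sym (*-identityˡ (f x))) (∑ₗ-filter P? xs f)
... | false = trans (∑ₗ-filter P? xs f) (sym (+-identityˡ _))

C[_,_] : ℕ → ℕ → ℤ
C[ n , k ] = + (n C k)

C-pascal : ∀ n k → C[ suc n , suc k ] ≡ C[ n , k ] + C[ n , suc k ]
C-pascal n k = trans (cong +_ (sym (nCk+nC[k+1]≡[n+1]C[k+1] n k))) (pos-+ (n C k) (n C suc k))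

C-vanish : ∀ {n k} → n ℕ.< k → C[ n , k ] ≡ 0ℤ
C-vanish n<k = cong +_ (k>n⇒nCk≡0 n<k)

C-hockey : ∀ N m → ∑ N (λ M → C[ M , m ]) ≡ C[ N , suc m ]
C-hockey zero    m = refl
C-hockey (suc N) m = begin
  ∑ N (λ M → C[ M , m ]) + C[ N , m ]   ≡⟨ cong (_+ C[ N , m ]) (C-hockey N m) ⟩
  C[ N , suc m ] + C[ N , m ]           ≡⟨ +-comm C[ N , suc m ] C[ N , m ] ⟩
  C[ N , m ] + C[ N , suc m ]           ≡⟨ C-pascal N m ⟨
  C[ suc N , suc m ]                    ∎

C-hockey-from : ∀ c {a m} → a ℕ.≤ m → ∑ c (λ τ → C[ τ ℕ.+ a , m ]) ≡ C[ c ℕ.+ a , suc m ]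
C-hockey-from zero    a≤m = sym (C-vanish (s≤s a≤m))
C-hockey-from (suc c) {a} {m} a≤m = begin
  ∑ c (λ τ → C[ τ ℕ.+ a , m ]) + C[ c ℕ.+ a , m ]   ≡⟨ cong (_+ C[ c ℕ.+ a , m ]) (C-hockey-from c a≤m) ⟩
  C[ c ℕ.+ a , suc m ] + C[ c ℕ.+ a , m ]           ≡⟨ +-comm C[ c ℕ.+ a , suc m ] C[ c ℕ.+ a , m ] ⟩
  C[ c ℕ.+ a , m ] + C[ c ℕ.+ a , suc m ]           ≡⟨ C-pascal (c ℕ.+ a) m ⟨
  C[ suc c ℕ.+ a , suc m ]                          ∎

C-vandermonde : ∀ r d n → ∑ (suc n) (λ i → C[ r , i ] * C[ d , n ℕ.∸ i ]) ≡ C[ r ℕ.+ d , n ]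
C-vandermonde zero    d n = begin
  ∑ (suc n) (λ i → C[ 0 , i ] * C[ d , n ℕ.∸ i ])   ≡⟨ ∑-first n _ ⟩
  1ℤ * C[ d , n ] + ∑ n (λ _ → 0ℤ)                   ≡⟨ cong (λ x → 1ℤ * C[ d , n ] + x) (∑-0 n) ⟩
  1ℤ * C[ d , n ] + 0ℤ                               ≡⟨ unit C[ d , n ] ⟩
  C[ d , n ]                                         ∎
  where unit : ∀ a → 1ℤ * a + 0ℤ ≡ a
        unit = solve-∀
C-vandermonde (suc r) d zero    = refl
C-vandermonde (suc r) d (suc n) = begin
  ∑ (suc (suc n)) (λ i → C[ suc r , i ] * C[ d , suc n ℕ.∸ i ])
    ≡⟨ ∑-first (suc n) _ ⟩
  first + ∑ (suc n) (λ i → C[ suc r , suc i ] * C[ d , n ℕ.∸ i ])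
    ≡⟨ cong (λ x → first + x) (trans (∑-cong (suc n) pascal) (∑-+ (suc n) lower upper)) ⟩
  first + (∑ (suc n) lower + ∑ (suc n) upper)
    ≡⟨ regroup first (∑ (suc n) lower) (∑ (suc n) upper) ⟩
  ∑ (suc n) lower + (first + ∑ (suc n) upper)
    ≡⟨ cong (λ x → ∑ (suc n) lower + x) (∑-first (suc n) (λ i → C[ r , i ] * C[ d , suc n ℕ.∸ i ])) ⟨
  ∑ (suc n) lower + ∑ (suc (suc n)) (λ i → C[ r , i ] * C[ d , suc n ℕ.∸ i ])
    ≡⟨ cong₂ _+_ (C-vandermonde r d n) (C-vandermonde r d (suc n)) ⟩
  C[ r ℕ.+ d , n ] + C[ r ℕ.+ d , suc n ]
    ≡⟨ C-pascal (r ℕ.+ d) n ⟨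
  C[ suc r ℕ.+ d , suc n ]
    ∎
  where
  first : ℤ
  first = 1ℤ * C[ d , suc n ]
  lower upper : ℕ → ℤ
  lower i = C[ r , i ] * C[ d , n ℕ.∸ i ]
  upper i = C[ r , suc i ] * C[ d , n ℕ.∸ i ]
  pascal : ∀ i → C[ suc r , suc i ] * C[ d , n ℕ.∸ i ] ≡ lower i + upper i
  pascal i = trans (cong (_* C[ d , n ℕ.∸ i ]) (C-pascal r i)) (*-distribʳ-+ C[ d , n ℕ.∸ i ] C[ r , i ] C[ r , suc i ])
  regroup : ∀ a b c → a + (b + c) ≡ b + (a + c)
  regroup = solve-∀

C-ratio : ∀ x i → + suc i * C[ x , suc i ] ≡ (+ x - + i) * C[ x , i ]
C-ratio zero    zero    = refl
C-ratio zero    (suc i) = trans (*-zeroʳ (+ suc (suc i))) (sym (*-zeroʳ (- + suc i)))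
C-ratio (suc x) zero    = begin
  1ℤ * C[ suc x , 1 ]      ≡⟨ cong (λ c → 1ℤ * + c) (nC1≡n (suc x)) ⟩
  1ℤ * + suc x             ≡⟨ unit (+ suc x) ⟩
  (+ suc x - 0ℤ) * 1ℤ      ∎
  where unit : ∀ a → 1ℤ * a ≡ (a - 0ℤ) * 1ℤ
        unit = solve-∀
C-ratio (suc x) (suc i) = begin
  + suc (suc i) * C[ suc x , suc (suc i) ]
    ≡⟨ cong (+ suc (suc i) *_) (C-pascal x (suc i)) ⟩
  + suc (suc i) * (C[ x , suc i ] + C[ x , suc (suc i) ])
    ≡⟨ step (+ x) (+ i) _ _ _ (C-ratio x (suc i)) (C-ratio x i) ⟩
  (+ suc x - + suc i) * (C[ x , i ] + C[ x , suc i ])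
    ≡⟨ cong (λ c → (+ suc x - + suc i) * c) (C-pascal x i) ⟨
  (+ suc x - + suc i) * C[ suc x , suc i ]
    ∎
  where
  step : ∀ X I c₀ c₁ c₂ → (1ℤ + (1ℤ + I)) * c₂ ≡ (X - (1ℤ + I)) * c₁ → (1ℤ + I) * c₁ ≡ (X - I) * c₀ →
         (1ℤ + (1ℤ + I)) * (c₁ + c₂) ≡ ((1ℤ + X) - (1ℤ + I)) * (c₀ + c₁)
  step X I c₀ c₁ c₂ h₂ h₁ = begin
    (1ℤ + (1ℤ + I)) * (c₁ + c₂)                       ≡⟨ expand X I c₁ c₂ ⟩
    (1ℤ + (1ℤ + I)) * c₁ + (1ℤ + (1ℤ + I)) * c₂       ≡⟨ cong (λ z → (1ℤ + (1ℤ + I)) * c₁ + z) h₂ ⟩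
    (1ℤ + (1ℤ + I)) * c₁ + (X - (1ℤ + I)) * c₁        ≡⟨ shuffle X I c₁ ⟩
    (1ℤ + I) * c₁ + (X - I) * c₁                      ≡⟨ cong (λ z → z + (X - I) * c₁) h₁ ⟩
    (X - I) * c₀ + (X - I) * c₁                       ≡⟨ collect X I c₀ c₁ ⟩
    ((1ℤ + X) - (1ℤ + I)) * (c₀ + c₁)                 ∎
    where
    expand : ∀ X I c₁ c₂ → (1ℤ + (1ℤ + I)) * (c₁ + c₂) ≡ (1ℤ + (1ℤ + I)) * c₁ + (1ℤ + (1ℤ + I)) * c₂
    expand = solve-∀
    shuffle : ∀ X I c₁ → (1ℤ + (1ℤ + I)) * c₁ + (X - (1ℤ + I)) * c₁ ≡ (1ℤ + I) * c₁ + (X - I) * c₁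
    shuffle = solve-∀
    collect : ∀ X I c₀ c₁ → (X - I) * c₀ + (X - I) * c₁ ≡ ((1ℤ + X) - (1ℤ + I)) * (c₀ + c₁)
    collect = solve-∀

C-mul-upper : ∀ r i → + r * C[ r , i ] ≡ + i * C[ r , i ] + + suc i * C[ r , suc i ]
C-mul-upper r i = begin
  + r * C[ r , i ]                                  ≡⟨ split (+ r) (+ i) C[ r , i ] ⟩
  + i * C[ r , i ] + (+ r - + i) * C[ r , i ]       ≡⟨ cong (λ x → + i * C[ r , i ] + x) (C-ratio r i) ⟨
  + i * C[ r , i ] + + suc i * C[ r , suc i ]       ∎
  where split : ∀ R I c → R * c ≡ I * c + (R - I) * c
        split = solve-∀

C-absorb : ∀ k j → C[ suc k , j ] * + (suc k ℕ.∸ j) ≡ + suc k * C[ k , j ]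
C-absorb k j with j ℕ.≤? suc k
... | no j≰1+k = begin
  C[ suc k , j ] * + (suc k ℕ.∸ j)   ≡⟨ cong (_* + (suc k ℕ.∸ j)) (C-vanish (ℕ.≰⇒> j≰1+k)) ⟩
  0ℤ                                 ≡⟨ *-zeroʳ (+ suc k) ⟨
  + suc k * 0ℤ                       ≡⟨ cong (+ suc k *_) (C-vanish (ℕ.<-trans (ℕ.n<1+n k) (ℕ.≰⇒> j≰1+k))) ⟨
  + suc k * C[ k , j ]               ∎
... | yes j≤1+k = begin
  C[ suc k , j ] * + (suc k ℕ.∸ j)
    ≡⟨ cong (C[ suc k , j ] *_) (sym (trans (m-n≡m⊖n (suc k) j) (⊖-≥ j≤1+k))) ⟩
  C[ suc k , j ] * (+ suc k - + j)
    ≡⟨ *-comm C[ suc k , j ] (+ suc k - + j) ⟩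
  (+ suc k - + j) * C[ suc k , j ]
    ≡⟨ C-ratio (suc k) j ⟨
  + suc j * C[ suc k , suc j ]
    ≡⟨ cong (+ suc j *_) (C-pascal k j) ⟩
  + suc j * (C[ k , j ] + C[ k , suc j ])
    ≡⟨ *-distribˡ-+ (+ suc j) C[ k , j ] C[ k , suc j ] ⟩
  + suc j * C[ k , j ] + + suc j * C[ k , suc j ]
    ≡⟨ cong (λ x → + suc j * C[ k , j ] + x) (C-ratio k j) ⟩
  + suc j * C[ k , j ] + (+ k - + j) * C[ k , j ]
    ≡⟨ collect (+ k) (+ j) C[ k , j ] ⟩
  + suc k * C[ k , j ]
    ∎
  where collect : ∀ K J c → (1ℤ + J) * c + (K - J) * c ≡ (1ℤ + K) * c
        collect = solve-∀

∑-pascal : ∀ d (X : ℕ → ℤ) → ∑ (suc (suc d)) (λ e → C[ suc d , e ] * X e) ≡ ∑ (suc d) (λ e → C[ d , e ] * (X e + X (suc e)))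
∑-pascal d X = begin
  ∑ (suc (suc d)) (λ e → C[ suc d , e ] * X e)
    ≡⟨ ∑-first (suc d) _ ⟩
  g 0 + ∑ (suc d) (λ e → C[ suc d , suc e ] * X (suc e))
    ≡⟨ cong (λ x → g 0 + x) (trans (∑-cong (suc d) pascal) (∑-+ (suc d) h (g ∘ suc))) ⟩
  g 0 + (∑ (suc d) h + ∑ (suc d) (g ∘ suc))
    ≡⟨ cong (λ x → g 0 + (∑ (suc d) h + x)) (∑-shift (suc d) g (cong (_* X (suc d)) (C-vanish (ℕ.n<1+n d)))) ⟩
  g 0 + (∑ (suc d) h + (∑ (suc d) g - g 0))
    ≡⟨ cancel (g 0) (∑ (suc d) h) (∑ (suc d) g) ⟩
  ∑ (suc d) g + ∑ (suc d) h
    ≡⟨ ∑-+ (suc d) g h ⟨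
  ∑ (suc d) (λ e → g e + h e)
    ≡⟨ ∑-cong (suc d) (λ e → sym (*-distribˡ-+ C[ d , e ] (X e) (X (suc e)))) ⟩
  ∑ (suc d) (λ e → C[ d , e ] * (X e + X (suc e)))
    ∎
  where
  g h : ℕ → ℤ
  g e = C[ d , e ] * X e
  h e = C[ d , e ] * X (suc e)
  pascal : ∀ e → C[ suc d , suc e ] * X (suc e) ≡ h e + g (suc e)
  pascal e = trans (cong (_* X (suc e)) (C-pascal d e)) (*-distribʳ-+ (X (suc e)) C[ d , e ] C[ d , suc e ])
  cancel : ∀ a b c → a + (b + (c - a)) ≡ c + b
  cancel = solve-∀

alternating-pascal : ∀ k (X : ℕ → ℤ) →
  ∑ (suc (suc k)) (λ j → sgn j * C[ suc k , j ] * X j) ≡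
  ∑ (suc k) (λ j → sgn j * C[ k , j ] * X j) - ∑ (suc k) (λ j → sgn j * C[ k , j ] * X (suc j))
alternating-pascal k X = begin
  ∑ (suc (suc k)) (λ j → sgn j * C[ suc k , j ] * X j)              ≡⟨ ∑-first (suc k) _ ⟩
  g 0 + ∑ (suc k) (λ j → sgn (suc j) * C[ suc k , suc j ] * X (suc j))
                                                                     ≡⟨ cong (λ x → g 0 + x) (∑-cong (suc k) pascal) ⟩
  g 0 + ∑ (suc k) (λ j → g (suc j) - h j)                           ≡⟨ cong (λ x → g 0 + x) (∑-- (suc k) (g ∘ suc) h) ⟩
  g 0 + (∑ (suc k) (g ∘ suc) - ∑ (suc k) h)                         ≡⟨ cong (λ x → g 0 + (x - ∑ (suc k) h)) (∑-shift (suc k) g g[k+1]≡0) ⟩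
  g 0 + (∑ (suc k) g - g 0 - ∑ (suc k) h)                           ≡⟨ cancel (g 0) (∑ (suc k) g) (∑ (suc k) h) ⟩
  ∑ (suc k) g - ∑ (suc k) h                                         ∎
  where
  g h : ℕ → ℤ
  g j = sgn j * C[ k , j ] * X j
  h j = sgn j * C[ k , j ] * X (suc j)
  pascal : ∀ j → sgn (suc j) * C[ suc k , suc j ] * X (suc j) ≡ g (suc j) - h j
  pascal j = trans (cong (λ c → - sgn j * c * X (suc j)) (C-pascal k j))
                   (expand (sgn j) C[ k , j ] C[ k , suc j ] (X (suc j)))
    where expand : ∀ s a b x → - s * (a + b) * x ≡ - s * b * x - s * a * x
          expand = solve-∀
  g[k+1]≡0 : g (suc k) ≡ 0ℤ
  g[k+1]≡0 = trans (cong (λ c → sgn (suc k) * c * X (suc k)) (C-vanish (ℕ.n<1+n k)))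
                   (cong (_* X (suc k)) (*-zeroʳ (sgn (suc k))))
  cancel : ∀ a b c → a + (b - a - c) ≡ b - c
  cancel = solve-∀

∑-upTo-diagonal : ∀ n i (f : ℕ → ℤ) → i ℕ.≤ n →
  ∑ (suc n) (λ k → C[ i , k ] * f k) ≡ ∑ i (λ k → C[ i , k ] * f k) + f i
∑-upTo-diagonal n i f i≤n = begin
  ∑ (suc n) (λ k → C[ i , k ] * f k)         ≡⟨ ∑-extend (suc i) (suc n) (s≤s i≤n) (λ k i<k → cong (_* f k) (C-vanish i<k)) ⟩
  ∑ i (λ k → C[ i , k ] * f k) + C[ i , i ] * f i
                                             ≡⟨ cong (λ c → ∑ i (λ k → C[ i , k ] * f k) + + c * f i) (nCn≡1 i) ⟩
  ∑ i (λ k → C[ i , k ] * f k) + 1ℤ * f i    ≡⟨ cong (λ x → ∑ i (λ k → C[ i , k ] * f k) + x) (*-identityˡ (f i)) ⟩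
  ∑ i (λ k → C[ i , k ] * f k) + f i         ∎

binomial-transform-injective : ∀ n (f g : ℕ → ℤ) →
  (∀ r → ∑ (suc n) (λ i → C[ r , i ] * f i) ≡ ∑ (suc n) (λ i → C[ r , i ] * g i)) →
  ∀ i → i ℕ.≤ n → f i ≡ g i
binomial-transform-injective n f g transform≡ = <-rec (λ i → i ℕ.≤ n → f i ≡ g i) step
  where
  step : ∀ i → (∀ {k} → k ℕ.< i → k ℕ.≤ n → f k ≡ g k) → i ℕ.≤ n → f i ≡ g i
  step i below i≤n = ∙-cancelˡ (∑ i (λ k → C[ i , k ] * f k)) (f i) (g i) (begin
    ∑ i (λ k → C[ i , k ] * f k) + f i
      ≡⟨ ∑-upTo-diagonal n i f i≤n ⟨
    ∑ (suc n) (λ k → C[ i , k ] * f k)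
      ≡⟨ transform≡ i ⟩
    ∑ (suc n) (λ k → C[ i , k ] * g k)
      ≡⟨ ∑-upTo-diagonal n i g i≤n ⟩
    ∑ i (λ k → C[ i , k ] * g k) + g i
      ≡⟨ cong (_+ g i) (∑-cong-< i (λ k k<i → cong (C[ i , k ] *_) (below k<i (ℕ.<⇒≤ (ℕ.<-≤-trans k<i i≤n))))) ⟨
    ∑ i (λ k → C[ i , k ] * f k) + g i    ∎)

surj : ℕ → ℕ → ℤ
surj q k = + (stirling2 q k ℕ.* k !)

stirling2-vanish : ∀ {q k} → q ℕ.< k → stirling2 q k ≡ 0
stirling2-vanish {zero}  {suc k} _         = refl
stirling2-vanish {suc q} {suc k} (s≤s q<k)
  rewrite stirling2-vanish q<k | stirling2-vanish (ℕ.m<n⇒m<1+n q<k) = trans (ℕ.+-identityʳ (k ℕ.* 0)) (ℕ.*-zeroʳ k)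

surj-vanish : ∀ {q k} → q ℕ.< k → surj q k ≡ 0ℤ
surj-vanish {q} {k} q<k = cong (λ s → + (s ℕ.* k !)) (stirling2-vanish q<k)

surj-suc : ∀ q k → surj (suc q) (suc k) ≡ + suc k * (surj q (suc k) + surj q k)
surj-suc q k = begin
  + ((suc k ℕ.* S₁ ℕ.+ S₀) ℕ.* (suc k ℕ.* k !))
    ≡⟨ cong +_ (regroup (suc k) S₁ S₀ (k !)) ⟩
  + (suc k ℕ.* (S₁ ℕ.* (suc k ℕ.* k !) ℕ.+ S₀ ℕ.* k !))
    ≡⟨ pos-* (suc k) _ ⟩
  + suc k * + (S₁ ℕ.* (suc k ℕ.* k !) ℕ.+ S₀ ℕ.* k !)
    ≡⟨ cong (+ suc k *_) (pos-+ (S₁ ℕ.* (suc k ℕ.* k !)) (S₀ ℕ.* k !)) ⟩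
  + suc k * (surj q (suc k) + surj q k)
    ∎
  where
  S₁ = stirling2 q (suc k)
  S₀ = stirling2 q k
  regroup : ∀ a s₁ s₀ f → (a ℕ.* s₁ ℕ.+ s₀) ℕ.* (a ℕ.* f) ≡ a ℕ.* (s₁ ℕ.* (a ℕ.* f) ℕ.+ s₀ ℕ.* f)
  regroup = ℕ-solve-∀

pow≡∑surj : ∀ r q → (+ r) ^ q ≡ ∑ (suc q) (λ i → C[ r , i ] * surj q i)
pow≡∑surj r zero    = refl
pow≡∑surj r (suc q) = begin
  + r * (+ r) ^ q                                             ≡⟨ cong (+ r *_) (pow≡∑surj r q) ⟩
  + r * ∑ (suc q) (λ i → C[ r , i ] * surj q i)             ≡⟨ ∑-*ˡ (suc q) (+ r) _ ⟨
  ∑ (suc q) (λ i → + r * (C[ r , i ] * surj q i))           ≡⟨ ∑-cong (suc q) split ⟩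
  ∑ (suc q) (λ i → lower i + upper i)                       ≡⟨ ∑-+ (suc q) lower upper ⟩
  ∑ (suc q) lower + ∑ (suc q) upper                         ≡⟨ cong (_+ ∑ (suc q) upper) lower-shift ⟨
  ∑ (suc q) (lower ∘ suc) + ∑ (suc q) upper                 ≡⟨ ∑-+ (suc q) (lower ∘ suc) upper ⟨
  ∑ (suc q) (λ i → lower (suc i) + upper i)                 ≡⟨ ∑-cong (suc q) combine ⟩
  ∑ (suc q) (λ i → C[ r , suc i ] * surj (suc q) (suc i))   ≡⟨ +-identityˡ _ ⟨
  0ℤ + ∑ (suc q) (λ i → C[ r , suc i ] * surj (suc q) (suc i))
                                                            ≡⟨ ∑-first (suc q) (λ i → C[ r , i ] * surj (suc q) i) ⟨
  ∑ (suc (suc q)) (λ i → C[ r , i ] * surj (suc q) i)       ∎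
  where
  lower upper : ℕ → ℤ
  lower i = + i * C[ r , i ] * surj q i
  upper i = + suc i * C[ r , suc i ] * surj q i
  split : ∀ i → + r * (C[ r , i ] * surj q i) ≡ lower i + upper i
  split i = begin
    + r * (C[ r , i ] * surj q i)                               ≡⟨ *-assoc (+ r) C[ r , i ] (surj q i) ⟨
    + r * C[ r , i ] * surj q i                                 ≡⟨ cong (_* surj q i) (C-mul-upper r i) ⟩
    (+ i * C[ r , i ] + + suc i * C[ r , suc i ]) * surj q i    ≡⟨ *-distribʳ-+ (surj q i) (+ i * C[ r , i ]) _ ⟩
    lower i + upper i                                           ∎
  lower-shift : ∑ (suc q) (lower ∘ suc) ≡ ∑ (suc q) lower
  lower-shift = begin
    ∑ (suc q) (lower ∘ suc)
      ≡⟨ ∑-shift (suc q) lower (trans (cong (+ suc q * C[ r , suc q ] *_) (surj-vanish (ℕ.n<1+n q))) (*-zeroʳ (+ suc q * C[ r , suc q ]))) ⟩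
    ∑ (suc q) lower - 0ℤ
      ≡⟨ +-identityʳ (∑ (suc q) lower) ⟩
    ∑ (suc q) lower
      ∎
  combine : ∀ i → lower (suc i) + upper i ≡ C[ r , suc i ] * surj (suc q) (suc i)
  combine i = trans (factor (+ suc i) C[ r , suc i ] (surj q (suc i)) (surj q i))
                    (cong (C[ r , suc i ] *_) (sym (surj-suc q i)))
    where factor : ∀ a c s₁ s₀ → a * c * s₁ + a * c * s₀ ≡ c * (a * (s₁ + s₀))
          factor = solve-∀

alt : ℕ → ℕ → ℤ
alt q k = ∑ (suc k) (λ j → sgn j * C[ k , j ] * (+ (k ℕ.∸ j)) ^ q)

alt-suc : ∀ q k → alt (suc q) (suc k) ≡ + suc k * (alt q (suc k) + alt q k)
alt-suc q k = begin
  alt (suc q) (suc k)                                  ≡⟨ ∑-cong (suc (suc k)) absorb ⟩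
  ∑ (suc (suc k)) (λ j → + suc k * g j)                ≡⟨ ∑-*ˡ (suc (suc k)) (+ suc k) g ⟩
  + suc k * (∑ (suc k) g + g (suc k))                  ≡⟨ cong (λ x → + suc k * (∑ (suc k) g + x)) g[k+1]≡0 ⟩
  + suc k * (∑ (suc k) g + 0ℤ)                         ≡⟨ cong (+ suc k *_) (+-identityʳ (∑ (suc k) g)) ⟩
  + suc k * ∑ (suc k) g                                ≡⟨ cong (+ suc k *_) difference ⟩
  + suc k * (alt q (suc k) + alt q k)                  ∎
  where
  X : ℕ → ℤ
  X j = (+ (suc k ℕ.∸ j)) ^ q
  g : ℕ → ℤ
  g j = sgn j * C[ k , j ] * X j
  absorb : ∀ j → sgn j * C[ suc k , j ] * (+ (suc k ℕ.∸ j)) ^ suc q ≡ + suc k * g j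
  absorb j = begin
    sgn j * C[ suc k , j ] * (+ (suc k ℕ.∸ j) * X j)    ≡⟨ regroup (sgn j) C[ suc k , j ] (+ (suc k ℕ.∸ j)) (X j) ⟩
    sgn j * (C[ suc k , j ] * + (suc k ℕ.∸ j)) * X j    ≡⟨ cong (λ c → sgn j * c * X j) (C-absorb k j) ⟩
    sgn j * (+ suc k * C[ k , j ]) * X j                ≡⟨ regroup′ (sgn j) (+ suc k) C[ k , j ] (X j) ⟩
    + suc k * g j                                       ∎
    where
    regroup : ∀ s c a x → s * c * (a * x) ≡ s * (c * a) * x
    regroup = solve-∀
    regroup′ : ∀ s a c x → s * (a * c) * x ≡ a * (s * c * x)
    regroup′ = solve-∀
  g[k+1]≡0 : g (suc k) ≡ 0ℤ
  g[k+1]≡0 = trans (cong (λ c → sgn (suc k) * c * X (suc k)) (C-vanish (ℕ.n<1+n k)))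
                   (cong (_* X (suc k)) (*-zeroʳ (sgn (suc k))))
  difference : ∑ (suc k) g ≡ alt q (suc k) + alt q k
  difference = begin
    ∑ (suc k) g                               ≡⟨ sub-add (∑ (suc k) g) (alt q k) ⟩
    ∑ (suc k) g - alt q k + alt q k           ≡⟨ cong (_+ alt q k) (alternating-pascal k X) ⟨
    alt q (suc k) + alt q k                   ∎
    where sub-add : ∀ a b → a ≡ a - b + b
          sub-add = solve-∀

alt≡surj : ∀ q k → alt q k ≡ surj q k
alt≡surj zero    zero    = refl
alt≡surj zero    (suc k) = trans (alternating-pascal k (λ _ → 1ℤ)) (+-inverseʳ (∑ (suc k) (λ j → sgn j * C[ k , j ] * 1ℤ)))
alt≡surj (suc q) zero    = refl
alt≡surj (suc q) (suc k) = begin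
  alt (suc q) (suc k)                          ≡⟨ alt-suc q k ⟩
  + suc k * (alt q (suc k) + alt q k)          ≡⟨ cong₂ (λ a b → + suc k * (a + b)) (alt≡surj q (suc k)) (alt≡surj q k) ⟩
  + suc k * (surj q (suc k) + surj q k)        ≡⟨ surj-suc q k ⟨
  surj (suc q) (suc k)                         ∎

+-Σℕ : ∀ n (f : ℕ → ℕ) → + Σℕ n f ≡ ∑ (suc n) (λ i → + f i)
+-Σℕ zero    f = refl
+-Σℕ (suc n) f = trans (pos-+ (Σℕ n f) (f (suc n))) (cong (_+ + f (suc n)) (+-Σℕ n f))

∑alt≡fub : ∀ {q} n → q ℕ.≤ n → ∑ (suc n) (alt q) ≡ + fub q
∑alt≡fub {q} n q≤n = begin
  ∑ (suc n) (alt q)     ≡⟨ ∑-cong (suc n) (alt≡surj q) ⟩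
  ∑ (suc n) (surj q)    ≡⟨ ∑-extend (suc q) (suc n) (s≤s q≤n) (λ i q<i → surj-vanish q<i) ⟩
  ∑ (suc q) (surj q)    ≡⟨ +-Σℕ q (λ i → stirling2 q i ℕ.* i !) ⟨
  + fub q               ∎

s₁ : ℕ → ℕ → ℤ
s₁ n q = sgn (n ℕ.∸ q) * + stirling1 n q

stirling1-vanish : ∀ {n q} → n ℕ.< q → stirling1 n q ≡ 0
stirling1-vanish {zero}  {suc q} _         = refl
stirling1-vanish {suc n} {suc q} (s≤s n<q)
  rewrite stirling1-vanish n<q | stirling1-vanish (ℕ.m<n⇒m<1+n n<q) = trans (ℕ.+-identityʳ (n ℕ.* 0)) (ℕ.*-zeroʳ n)

sgn-∸-suc : ∀ {n q} → q ℕ.< n → sgn (n ℕ.∸ q) ≡ - sgn (n ℕ.∸ suc q)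
sgn-∸-suc {suc n} {zero}  _         = refl
sgn-∸-suc {suc n} {suc q} (s≤s q<n) = sgn-∸-suc q<n

s₁-suc : ∀ n q → s₁ (suc n) (suc q) ≡ s₁ n q - + n * s₁ n (suc q)
s₁-suc n q = begin
  sgn (n ℕ.∸ q) * + (n ℕ.* stirling1 n (suc q) ℕ.+ stirling1 n q)
    ≡⟨ cong (sgn (n ℕ.∸ q) *_) (trans (pos-+ (n ℕ.* stirling1 n (suc q)) _) (cong (_+ + stirling1 n q) (pos-* n _))) ⟩
  sgn (n ℕ.∸ q) * (+ n * + stirling1 n (suc q) + + stirling1 n q)
    ≡⟨ distribute (sgn (n ℕ.∸ q)) (+ n) (+ stirling1 n (suc q)) (+ stirling1 n q) ⟩
  s₁ n q + + n * (sgn (n ℕ.∸ q) * + stirling1 n (suc q))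
    ≡⟨ cong (λ x → s₁ n q + + n * x) sign-flip ⟩
  s₁ n q + + n * (- s₁ n (suc q))
    ≡⟨ cong (λ x → s₁ n q + x) (neg-distribʳ-* (+ n) (s₁ n (suc q))) ⟨
  s₁ n q - + n * s₁ n (suc q)
    ∎
  where
  distribute : ∀ s a b c → s * (a * b + c) ≡ s * c + a * (s * b)
  distribute = solve-∀
  sign-flip : sgn (n ℕ.∸ q) * + stirling1 n (suc q) ≡ - s₁ n (suc q)
  sign-flip with q ℕ.<? n
  ... | yes q<n rewrite sgn-∸-suc q<n = sym (neg-distribˡ-* (sgn (n ℕ.∸ suc q)) (+ stirling1 n (suc q)))
  ... | no q≮n rewrite stirling1-vanish (s≤s (ℕ.≮⇒≥ q≮n)) =
        trans (*-zeroʳ (sgn (n ℕ.∸ q))) (sym (cong -_ (*-zeroʳ (sgn (n ℕ.∸ suc q)))))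

falling-factorial : ∀ n x → + (n !) * C[ x , n ] ≡ ∑ (suc n) (λ q → s₁ n q * (+ x) ^ q)
falling-factorial zero    x = refl
falling-factorial (suc n) x = begin
  + (suc n ℕ.* n !) * C[ x , suc n ]                  ≡⟨ cong (_* C[ x , suc n ]) (pos-* (suc n) (n !)) ⟩
  + suc n * + (n !) * C[ x , suc n ]                  ≡⟨ swap (+ suc n) (+ (n !)) C[ x , suc n ] ⟩
  + (n !) * (+ suc n * C[ x , suc n ])                ≡⟨ cong (+ (n !) *_) (C-ratio x n) ⟩
  + (n !) * ((+ x - + n) * C[ x , n ])                ≡⟨ swap′ (+ (n !)) (+ x - + n) C[ x , n ] ⟩
  (+ x - + n) * (+ (n !) * C[ x , n ])                ≡⟨ cong ((+ x - + n) *_) (falling-factorial n x) ⟩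
  (+ x - + n) * ∑ (suc n) f                           ≡⟨ split (+ x) (+ n) (∑ (suc n) f) (f 0) (n*f[0]≡0 n) ⟩
  + x * ∑ (suc n) f - + n * (∑ (suc n) f - f 0)       ≡⟨ cong (λ z → + x * ∑ (suc n) f - + n * z) (∑-shift (suc n) f f[n+1]≡0) ⟨
  + x * ∑ (suc n) f - + n * ∑ (suc n) (f ∘ suc)       ≡⟨ cong₂ _-_ (∑-*ˡ (suc n) (+ x) f) (∑-*ˡ (suc n) (+ n) (f ∘ suc)) ⟨
  ∑ (suc n) (λ q → + x * f q) - ∑ (suc n) (λ q → + n * f (suc q))
                                                      ≡⟨ ∑-- (suc n) _ _ ⟨
  ∑ (suc n) (λ q → + x * f q - + n * f (suc q))       ≡⟨ ∑-cong (suc n) recurrence ⟩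
  ∑ (suc n) (λ q → s₁ (suc n) (suc q) * (+ x) ^ suc q) ≡⟨ drop-constant ⟨
  ∑ (suc (suc n)) (λ q → s₁ (suc n) q * (+ x) ^ q)    ∎
  where
  f : ℕ → ℤ
  f q = s₁ n q * (+ x) ^ q
  drop-constant : ∑ (suc (suc n)) (λ q → s₁ (suc n) q * (+ x) ^ q) ≡ ∑ (suc n) (λ q → s₁ (suc n) (suc q) * (+ x) ^ suc q)
  drop-constant = begin
    ∑ (suc (suc n)) (λ q → s₁ (suc n) q * (+ x) ^ q)   ≡⟨ ∑-first (suc n) (λ q → s₁ (suc n) q * (+ x) ^ q) ⟩
    s₁ (suc n) 0 * 1ℤ + rest                          ≡⟨ cong (λ s → s * 1ℤ + rest) (*-zeroʳ (sgn (suc n))) ⟩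
    0ℤ + rest                                         ≡⟨ +-identityˡ rest ⟩
    rest                                              ∎
    where rest = ∑ (suc n) (λ q → s₁ (suc n) (suc q) * (+ x) ^ suc q)
  f[n+1]≡0 : f (suc n) ≡ 0ℤ
  f[n+1]≡0 rewrite stirling1-vanish (ℕ.n<1+n n) = cong (_* (+ x) ^ suc n) (*-zeroʳ (sgn (n ℕ.∸ suc n)))
  n*f[0]≡0 : ∀ n → + n * (s₁ n 0 * 1ℤ) ≡ 0ℤ
  n*f[0]≡0 zero    = refl
  n*f[0]≡0 (suc n) = trans (cong (λ z → + suc n * (z * 1ℤ)) (*-zeroʳ (sgn (suc n)))) (*-zeroʳ (+ suc n))
  swap : ∀ a b c → a * b * c ≡ b * (a * c)
  swap = solve-∀
  swap′ : ∀ a b c → a * (b * c) ≡ b * (a * c)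
  swap′ = solve-∀
  split : ∀ X N F f₀ → N * f₀ ≡ 0ℤ → (X - N) * F ≡ X * F - N * (F - f₀)
  split X N F f₀ N*f₀≡0 = trans (sym (+-identityʳ ((X - N) * F)))
                                (trans (cong (λ z → (X - N) * F + z) (sym N*f₀≡0)) (expand X N F f₀))
    where expand : ∀ X N F f₀ → (X - N) * F + N * f₀ ≡ X * F - N * (F - f₀)
          expand = solve-∀
  recurrence : ∀ q → + x * f q - + n * f (suc q) ≡ s₁ (suc n) (suc q) * (+ x) ^ suc q
  recurrence q = trans (factor (s₁ n q) (+ n) (s₁ n (suc q)) (+ x) ((+ x) ^ q))
                       (cong (_* (+ x) ^ suc q) (sym (s₁-suc n q)))
    where factor : ∀ a N b X p → X * (a * p) - N * (b * (X * p)) ≡ (a - N * b) * (X * p)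
          factor = solve-∀

^-distribʳ-* : ∀ a b q → (a * b) ^ q ≡ a ^ q * b ^ q
^-distribʳ-* a b zero    = refl
^-distribʳ-* a b (suc q) = trans (cong (a * b *_) (^-distribʳ-* a b q)) (interchange a b (a ^ q) (b ^ q))
  where interchange : ∀ a b x y → a * b * (x * y) ≡ a * x * (b * y)
        interchange = solve-∀

stirlingFubini : ℕ → ℕ → ℤ
stirlingFubini n r = ∑ (suc n) (λ q → s₁ n q * + fub q * (+ r) ^ q)

falling-factorial-* : ∀ n r m → + (n !) * C[ r ℕ.* m , n ] ≡ ∑ (suc n) (λ q → s₁ n q * (+ r) ^ q * (+ m) ^ q)
falling-factorial-* n r m = begin
  + (n !) * C[ r ℕ.* m , n ]
    ≡⟨ falling-factorial n (r ℕ.* m) ⟩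
  ∑ (suc n) (λ q → s₁ n q * (+ (r ℕ.* m)) ^ q)
    ≡⟨ ∑-cong (suc n) (λ q → cong (λ x → s₁ n q * x ^ q) (pos-* r m)) ⟩
  ∑ (suc n) (λ q → s₁ n q * (+ r * + m) ^ q)
    ≡⟨ ∑-cong (suc n) (λ q → cong (s₁ n q *_) (^-distribʳ-* (+ r) (+ m) q)) ⟩
  ∑ (suc n) (λ q → s₁ n q * ((+ r) ^ q * (+ m) ^ q))
    ≡⟨ ∑-cong (suc n) (λ q → sym (*-assoc (s₁ n q) ((+ r) ^ q) ((+ m) ^ q))) ⟩
  ∑ (suc n) (λ q → s₁ n q * (+ r) ^ q * (+ m) ^ q)
    ∎

fubini-expansion : ∀ n r →
  + (n !) * ∑ (suc n) (λ k → ∑ (suc k) (λ j → sgn j * C[ k , j ] * C[ r ℕ.* (k ℕ.∸ j) , n ])) ≡ stirlingFubini n r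
fubini-expansion n r = begin
  + (n !) * ∑ (suc n) (λ k → ∑ (suc k) (λ j → sgn j * C[ k , j ] * C[ r ℕ.* (k ℕ.∸ j) , n ]))
    ≡⟨ ∑-*ˡ (suc n) (+ (n !)) _ ⟨
  ∑ (suc n) (λ k → + (n !) * ∑ (suc k) (λ j → sgn j * C[ k , j ] * C[ r ℕ.* (k ℕ.∸ j) , n ]))
    ≡⟨ ∑-cong (suc n) (λ k → trans (sym (∑-*ˡ (suc k) (+ (n !)) _)) (∑-cong (suc k) (expand k))) ⟩
  ∑ (suc n) (λ k → ∑ (suc k) (λ j → ∑ (suc n) (λ q → w q * term q k j)))
    ≡⟨ ∑-cong (suc n) (λ k → ∑-swap (suc k) (suc n) _) ⟩
  ∑ (suc n) (λ k → ∑ (suc n) (λ q → ∑ (suc k) (λ j → w q * term q k j)))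
    ≡⟨ ∑-swap (suc n) (suc n) _ ⟩
  ∑ (suc n) (λ q → ∑ (suc n) (λ k → ∑ (suc k) (λ j → w q * term q k j)))
    ≡⟨ ∑-cong (suc n) (λ q → trans (∑-cong (suc n) (λ k → ∑-*ˡ (suc k) (w q) (term q k))) (∑-*ˡ (suc n) (w q) (alt q))) ⟩
  ∑ (suc n) (λ q → w q * ∑ (suc n) (alt q))
    ≡⟨ ∑-cong-< (suc n) (λ q q<1+n → cong (w q *_) (∑alt≡fub n (ℕ.≤-pred q<1+n))) ⟩
  ∑ (suc n) (λ q → w q * + fub q)
    ≡⟨ ∑-cong (suc n) (λ q → reorder (s₁ n q) ((+ r) ^ q) (+ fub q)) ⟩
  stirlingFubini n r
    ∎
  where
  w : ℕ → ℤ
  w q = s₁ n q * (+ r) ^ q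
  term : ℕ → ℕ → ℕ → ℤ
  term q k j = sgn j * C[ k , j ] * (+ (k ℕ.∸ j)) ^ q
  reorder : ∀ a b c → a * b * c ≡ a * c * b
  reorder = solve-∀
  expand : ∀ k j → + (n !) * (sgn j * C[ k , j ] * C[ r ℕ.* (k ℕ.∸ j) , n ]) ≡ ∑ (suc n) (λ q → w q * term q k j)
  expand k j = begin
    + (n !) * (sgn j * C[ k , j ] * C[ r ℕ.* m , n ])
      ≡⟨ swap (+ (n !)) (sgn j * C[ k , j ]) C[ r ℕ.* m , n ] ⟩
    sgn j * C[ k , j ] * (+ (n !) * C[ r ℕ.* m , n ])
      ≡⟨ cong (sgn j * C[ k , j ] *_) (falling-factorial-* n r m) ⟩
    sgn j * C[ k , j ] * ∑ (suc n) (λ q → w q * (+ m) ^ q)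
      ≡⟨ ∑-*ˡ (suc n) (sgn j * C[ k , j ]) _ ⟨
    ∑ (suc n) (λ q → sgn j * C[ k , j ] * (w q * (+ m) ^ q))
      ≡⟨ ∑-cong (suc n) (λ q → swap (sgn j * C[ k , j ]) (w q) ((+ m) ^ q)) ⟩
    ∑ (suc n) (λ q → w q * term q k j)
      ∎
    where
    m = k ℕ.∸ j
    swap : ∀ a b c → a * (b * c) ≡ b * (a * c)
    swap = solve-∀

coeff-⊕ : ∀ p q j → coeff (p ⊕ q) j ≡ coeff p j + coeff q j
coeff-⊕ []      q       j       = sym (+-identityˡ (coeff q j))
coeff-⊕ (a ∷ p) []      j       = sym (+-identityʳ (coeff (a ∷ p) j))
coeff-⊕ (a ∷ p) (b ∷ q) zero    = refl
coeff-⊕ (a ∷ p) (b ∷ q) (suc j) = coeff-⊕ p q j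

coeff-scale : ∀ c p j → coeff (scale c p) j ≡ c * coeff p j
coeff-scale c []      j       = sym (*-zeroʳ c)
coeff-scale c (a ∷ p) zero    = refl
coeff-scale c (a ∷ p) (suc j) = coeff-scale c p j

coeff-ΣP : ∀ n f j → coeff (ΣP n f) j ≡ ∑ (suc n) (λ k → coeff (f k) j)
coeff-ΣP zero    f j = sym (+-identityˡ (coeff (f 0) j))
coeff-ΣP (suc n) f j = trans (coeff-⊕ (ΣP n f) (f (suc n)) j) (cong (_+ coeff (f (suc n)) j) (coeff-ΣP n f j))

coeff-[0] : ∀ j → coeff (+ 0 ∷ []) j ≡ 0ℤ
coeff-[0] zero    = refl
coeff-[0] (suc j) = refl

coeff-[t-1]⊗-zero : ∀ p → coeff (tMinus1 ⊗ p) 0 ≡ - coeff p 0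
coeff-[t-1]⊗-zero p = begin
  coeff (scale (- 1ℤ) p ⊕ (+ 0 ∷ ((+ 1 ∷ []) ⊗ p))) 0    ≡⟨ coeff-⊕ (scale (- 1ℤ) p) _ 0 ⟩
  coeff (scale (- 1ℤ) p) 0 + 0ℤ                          ≡⟨ cong (_+ 0ℤ) (coeff-scale (- 1ℤ) p 0) ⟩
  - 1ℤ * coeff p 0 + 0ℤ                                  ≡⟨ simplify (coeff p 0) ⟩
  - coeff p 0                                            ∎
  where simplify : ∀ x → - 1ℤ * x + 0ℤ ≡ - x
        simplify = solve-∀

coeff-[t-1]⊗-suc : ∀ p j → coeff (tMinus1 ⊗ p) (suc j) ≡ coeff p j - coeff p (suc j)
coeff-[t-1]⊗-suc p j = begin
  coeff (scale (- 1ℤ) p ⊕ (+ 0 ∷ (scale 1ℤ p ⊕ (+ 0 ∷ [])))) (suc j)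
    ≡⟨ coeff-⊕ (scale (- 1ℤ) p) _ (suc j) ⟩
  coeff (scale (- 1ℤ) p) (suc j) + coeff (scale 1ℤ p ⊕ (+ 0 ∷ [])) j
    ≡⟨ cong₂ _+_ (coeff-scale (- 1ℤ) p (suc j))
                 (trans (coeff-⊕ (scale 1ℤ p) (+ 0 ∷ []) j) (cong₂ _+_ (coeff-scale 1ℤ p j) (coeff-[0] j))) ⟩
  - 1ℤ * coeff p (suc j) + (1ℤ * coeff p j + 0ℤ)
    ≡⟨ simplify (coeff p (suc j)) (coeff p j) ⟩
  coeff p j - coeff p (suc j)
    ∎
  where simplify : ∀ x y → - 1ℤ * x + (1ℤ * y + 0ℤ) ≡ y - x
        simplify = solve-∀

coeff[t-1]^ : ℕ → ℕ → ℤ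
coeff[t-1]^ e j = coeff (tMinus1 ^ₚ e) j

coeff-tpow : ∀ d j → coeff (tpow d) j ≡ ∑ (suc d) (λ e → C[ d , e ] * coeff[t-1]^ e j)
coeff-tpow zero    j = sym (trans (+-identityˡ _) (*-identityˡ (coeff (tpow 0) j)))
coeff-tpow (suc d) j = sym (trans (∑-pascal d (λ e → coeff[t-1]^ e j)) (step j))
  where
  step : ∀ j → ∑ (suc d) (λ e → C[ d , e ] * (coeff[t-1]^ e j + coeff[t-1]^ (suc e) j)) ≡ coeff (tpow (suc d)) j
  step zero    = ∑-zero (suc d) (λ e _ → trans (cong (C[ d , e ] *_) (cancel e)) (*-zeroʳ C[ d , e ]))
    where
    cancel : ∀ e → coeff[t-1]^ e 0 + coeff[t-1]^ (suc e) 0 ≡ 0ℤ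
    cancel e = trans (cong (λ x → coeff[t-1]^ e 0 + x) (coeff-[t-1]⊗-zero (tMinus1 ^ₚ e))) (+-inverseʳ (coeff[t-1]^ e 0))
  step (suc j) = trans (∑-cong (suc d) (λ e → cong (C[ d , e ] *_) (telescope e))) (sym (coeff-tpow d j))
    where
    telescope : ∀ e → coeff[t-1]^ e (suc j) + coeff[t-1]^ (suc e) (suc j) ≡ coeff[t-1]^ e j
    telescope e = trans (cong (λ x → coeff[t-1]^ e (suc j) + x) (coeff-[t-1]⊗-suc (tMinus1 ^ₚ e) j))
                        (add-sub (coeff[t-1]^ e (suc j)) (coeff[t-1]^ e j))
      where add-sub : ∀ a b → a + (b - a) ≡ b
            add-sub = solve-∀

wordsOver : List ℕ → ℕ → List (List ℕ)
wordsOver L zero    = [] ∷ []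
wordsOver L (suc m) = concatMap (λ w → map (_∷ w) L) (wordsOver L m)

letters : ℕ → List ℕ
letters b = map suc (upTo b)

words≡wordsOver-letters : ∀ b m → words b m ≡ wordsOver (letters b) m
words≡wordsOver-letters b zero    = refl
words≡wordsOver-letters b (suc m) = begin
  concatMap (λ w → map (λ a → suc a ∷ w) (upTo b)) (words b m)
    ≡⟨ cong (concatMap (λ w → map (λ a → suc a ∷ w) (upTo b))) (words≡wordsOver-letters b m) ⟩
  concatMap (λ w → map (λ a → suc a ∷ w) (upTo b)) (wordsOver (letters b) m)
    ≡⟨ concatMap-cong (λ w → map-∘ (upTo b)) (wordsOver (letters b) m) ⟩
  concatMap (λ w → map (_∷ w) (letters b)) (wordsOver (letters b) m)
    ∎

∑ₗ-wordsOver-suc : ∀ L m (F : List ℕ → ℤ) → ∑ₗ (wordsOver L (suc m)) F ≡ ∑ₗ (wordsOver L m) (λ w → ∑ₗ L (λ a → F (a ∷ w)))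
∑ₗ-wordsOver-suc L m F = trans (∑ₗ-concatMap _ (wordsOver L m) F) (∑ₗ-cong (wordsOver L m) (λ w → ∑ₗ-map (_∷ w) L F))

∑ₗ-wordsOver-cong : ∀ {P : ℕ → Set} {L} m {F G : List ℕ → ℤ} → All P L →
  (∀ w → length w ≡ m → All P w → F w ≡ G w) → ∑ₗ (wordsOver L m) F ≡ ∑ₗ (wordsOver L m) G
∑ₗ-wordsOver-cong zero    PL eq = cong (_+ 0ℤ) (eq [] refl [])
∑ₗ-wordsOver-cong {L = L} (suc m) {F} {G} PL eq = begin
  ∑ₗ (wordsOver L (suc m)) F
    ≡⟨ ∑ₗ-wordsOver-suc L m F ⟩
  ∑ₗ (wordsOver L m) (λ w → ∑ₗ L (λ a → F (a ∷ w)))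
    ≡⟨ ∑ₗ-wordsOver-cong m PL (λ w len Pw → ∑ₗ-cong-All PL (λ a Pa → eq (a ∷ w) (cong suc len) (Pa ∷ Pw))) ⟩
  ∑ₗ (wordsOver L m) (λ w → ∑ₗ L (λ a → G (a ∷ w)))
    ≡⟨ ∑ₗ-wordsOver-suc L m G ⟨
  ∑ₗ (wordsOver L (suc m)) G
    ∎

InRange : ℕ → ℕ → Set
InRange b a = 1 ℕ.≤ a × a ℕ.≤ b

letters-InRange : ∀ b → All (InRange b) (letters b)
letters-InRange b = Allₚ.map⁺ (Allₚ.applyUpTo⁺₁ (λ i → i) b (λ i<b → s≤s z≤n , i<b))

∑ₗ-letters : ∀ b (f : ℕ → ℤ) → ∑ₗ (letters b) f ≡ ∑ b (f ∘ suc)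
∑ₗ-letters b f = trans (∑ₗ-map suc (upTo b) f) (∑ₗ-applyUpTo (λ i → i) b (f ∘ suc))

letters-∷ʳ : ∀ b → letters (suc b) ≡ letters b ++ suc b ∷ []
letters-∷ʳ b = trans (cong (map suc) (sym (applyUpTo-∷ʳ (λ x → x) b))) (map-++ suc (upTo b) (b ∷ []))

des-∷≤length : ∀ y w → des (y ∷ w) ℕ.≤ length w
des-∷≤length y []      = z≤n
des-∷≤length y (z ∷ w) = ℕ.+-mono-≤ (indicator≤1 (z <ᵇ y)) (des-∷≤length z w)
  where indicator≤1 : ∀ b → (if b then 1 else 0) ℕ.≤ 1
        indicator≤1 true  = ℕ.≤-refl
        indicator≤1 false = z≤n

des≤length : ∀ w → des w ℕ.≤ length w
des≤length []      = z≤n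
des≤length (y ∷ w) = ℕ.m≤n⇒m≤1+n (des-∷≤length y w)

-- Peeling off the first letter a of the word, the hockey stick splits C[ σ + des , m + 1 ] into a sum over
-- τ < σ + [a < x], the induction hypothesis turns each term into C[ τ b + a , m ], and ∑-interleave
-- and the hockey stick reassemble these into C[ σ b + x , m + 1 ].
∑-words-C-des-∷ : ∀ b m σ x → x ℕ.≤ b →
  ∑ₗ (wordsOver (letters b) m) (λ w → C[ σ ℕ.+ des (suc x ∷ w) , m ]) ≡ C[ σ ℕ.* b ℕ.+ x , m ]
∑-words-C-des-∷ b zero    σ x x≤b = refl
∑-words-C-des-∷ b (suc m) σ x x≤b = begin
  ∑ₗ (wordsOver (letters b) (suc m)) (λ w → C[ σ ℕ.+ des (suc x ∷ w) , suc m ])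
    ≡⟨ ∑ₗ-wordsOver-suc (letters b) m _ ⟩
  ∑ₗ (wordsOver (letters b) m) (λ w → ∑ₗ (letters b) (λ a → C[ σ ℕ.+ des (suc x ∷ a ∷ w) , suc m ]))
    ≡⟨ ∑ₗ-wordsOver-cong m (letters-InRange b) (λ w len _ → trans (∑ₗ-letters b _) (∑-cong b (λ a → peel a w len))) ⟩
  ∑ₗ (wordsOver (letters b) m) (λ w → ∑ b (λ a → ∑ (c a) (λ τ → C[ τ ℕ.+ des (suc a ∷ w) , m ])))
    ≡⟨ ∑ₗ-∑ (wordsOver (letters b) m) b _ ⟩
  ∑ b (λ a → ∑ₗ (wordsOver (letters b) m) (λ w → ∑ (c a) (λ τ → C[ τ ℕ.+ des (suc a ∷ w) , m ])))
    ≡⟨ ∑-cong-< b (λ a a<b → trans (∑ₗ-∑ (wordsOver (letters b) m) (c a) _)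
                                    (∑-cong (c a) (λ τ → ∑-words-C-des-∷ b m τ a (ℕ.<⇒≤ a<b)))) ⟩
  ∑ b (λ a → ∑ (c a) (λ τ → C[ τ ℕ.* b ℕ.+ a , m ]))
    ≡⟨ ∑-interleave σ x b (λ N → C[ N , m ]) x≤b ⟩
  ∑ (σ ℕ.* b ℕ.+ x) (λ N → C[ N , m ])
    ≡⟨ C-hockey (σ ℕ.* b ℕ.+ x) m ⟩
  C[ σ ℕ.* b ℕ.+ x , suc m ]
    ∎
  where
  c : ℕ → ℕ
  c a = σ ℕ.+ (if a <ᵇ x then 1 else 0)
  peel : ∀ a w → length w ≡ m → C[ σ ℕ.+ des (suc x ∷ suc a ∷ w) , suc m ] ≡ ∑ (c a) (λ τ → C[ τ ℕ.+ des (suc a ∷ w) , m ])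
  peel a w refl = trans (cong (λ N → C[ N , suc m ]) (sym (ℕ.+-assoc σ (if a <ᵇ x then 1 else 0) (des (suc a ∷ w)))))
                        (sym (C-hockey-from (c a) (des-∷≤length (suc a) w)))

∑-words-C-des : ∀ b m s → ∑ₗ (wordsOver (letters b) m) (λ w → C[ s ℕ.+ des w , m ]) ≡ C[ s ℕ.* b , m ]
∑-words-C-des b m s = begin
  ∑ₗ (wordsOver (letters b) m) (λ w → C[ s ℕ.+ des w , m ])
    ≡⟨ ∑ₗ-wordsOver-cong m (letters-InRange b) (λ w _ positive → cong (λ d → C[ s ℕ.+ d , m ]) (sym (des-1∷ w positive))) ⟩
  ∑ₗ (wordsOver (letters b) m) (λ w → C[ s ℕ.+ des (1 ∷ w) , m ])
    ≡⟨ ∑-words-C-des-∷ b m s 0 z≤n ⟩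
  C[ s ℕ.* b ℕ.+ 0 , m ]
    ≡⟨ cong (λ N → C[ N , m ]) (ℕ.+-identityʳ (s ℕ.* b)) ⟩
  C[ s ℕ.* b , m ]
    ∎
  where
  des-1∷ : ∀ w → All (InRange b) w → des (1 ∷ w) ≡ des w
  des-1∷ []          _ = refl
  des-1∷ (suc a ∷ w) _ = refl
  des-1∷ (zero ∷ w)  ((() , _) ∷ _)

allB-++ : ∀ (p : ℕ → Bool) xs ys → allB p (xs ++ ys) ≡ allB p xs ∧ allB p ys
allB-++ p []       ys = refl
allB-++ p (x ∷ xs) ys = trans (cong (p x ∧_) (allB-++ p xs ys)) (sym (∧-assoc (p x) (allB p xs) (allB p ys)))

maxL≤ : ∀ k w → allB (λ x → x ≤ᵇ k) w ≡ true → maxL w ℕ.≤ k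
maxL≤ k []      _ = z≤n
maxL≤ k (x ∷ w) h with x ≤ᵇ k in x≤ᵇk
... | true  = ℕ.⊔-lub (ℕ.≤ᵇ⇒≤ x k (Equivalence.from T-≡ x≤ᵇk)) (maxL≤ k w h)

allB-≤ᵇ : ∀ k w → maxL w ℕ.≤ k → allB (λ x → x ≤ᵇ k) w ≡ true
allB-≤ᵇ k []      _   = refl
allB-≤ᵇ k (x ∷ w) m≤k rewrite ≤ᵇ≡true (ℕ.m⊔n≤o⇒m≤o x (maxL w) m≤k) = allB-≤ᵇ k w (ℕ.m⊔n≤o⇒n≤o x (maxL w) m≤k)

occurs⇒≤maxL : ∀ v w → occurs v w ≡ true → v ℕ.≤ maxL w
occurs⇒≤maxL v (x ∷ w) h with x ≡ᵇ v in x≡ᵇv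
... | true  rewrite ℕ.≡ᵇ⇒≡ x v (Equivalence.from T-≡ x≡ᵇv) = ℕ.m≤m⊔n v (maxL w)
... | false = ℕ.≤-trans (occurs⇒≤maxL v w h) (ℕ.m≤n⊔m x (maxL w))

maxL-InRange : ∀ {n} w → All (InRange n) w → maxL w ℕ.≤ n
maxL-InRange []      []               = z≤n
maxL-InRange (x ∷ w) ((_ , x≤n) ∷ ws) = ℕ.⊔-lub x≤n (maxL-InRange w ws)

allB-positive : ∀ {n} w → All (InRange n) w → allB (λ x → 1 ≤ᵇ x) w ≡ true
allB-positive []      []                   = refl
allB-positive (suc x ∷ w) ((s≤s z≤n , _) ∷ ws) = allB-positive w ws

containsUpTo : ℕ → List ℕ → Bool
containsUpTo zero    w = true
containsUpTo (suc p) w = containsUpTo p w ∧ occurs (suc p) w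

allB-occurs≡containsUpTo : ∀ p w → allB (λ v → occurs (suc v) w) (upTo p) ≡ containsUpTo p w
allB-occurs≡containsUpTo zero    w = refl
allB-occurs≡containsUpTo (suc p) w = begin
  allB (λ v → occurs (suc v) w) (upTo (suc p))
    ≡⟨ cong (allB (λ v → occurs (suc v) w)) (applyUpTo-∷ʳ (λ x → x) p) ⟨
  allB (λ v → occurs (suc v) w) (upTo p ++ p ∷ [])
    ≡⟨ allB-++ (λ v → occurs (suc v) w) (upTo p) (p ∷ []) ⟩
  allB (λ v → occurs (suc v) w) (upTo p) ∧ (occurs (suc p) w ∧ true)
    ≡⟨ cong₂ _∧_ (allB-occurs≡containsUpTo p w) (∧-identityʳ (occurs (suc p) w)) ⟩
  containsUpTo p w ∧ occurs (suc p) w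
    ∎

-- A word is a Cayley permutation iff some k, necessarily its maximum, bounds it and it contains 1, …, k.
⟦isCayley⟧≡∑ : ∀ n w → All (InRange n) w →
  ⟦ isCayley w ⟧ ≡ ∑ (suc n) (λ k → ⟦ allB (λ x → x ≤ᵇ k) w ⟧ * ⟦ containsUpTo k w ⟧)
⟦isCayley⟧≡∑ n w ws = begin
  ⟦ allB (λ x → 1 ≤ᵇ x) w ∧ allB (λ v → occurs (suc v) w) (upTo M) ⟧
    ≡⟨ cong₂ (λ a b → ⟦ a ∧ b ⟧) (allB-positive w ws) (allB-occurs≡containsUpTo M w) ⟩
  ⟦ containsUpTo M w ⟧
    ≡⟨ *-identityˡ ⟦ containsUpTo M w ⟧ ⟨
  1ℤ * ⟦ containsUpTo M w ⟧
    ≡⟨ cong (λ b → ⟦ b ⟧ * ⟦ containsUpTo M w ⟧) (allB-≤ᵇ M w ℕ.≤-refl) ⟨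
  ⟦ allB (λ x → x ≤ᵇ M) w ⟧ * ⟦ containsUpTo M w ⟧
    ≡⟨ ∑-single (suc n) M (s≤s (maxL-InRange w ws)) others ⟨
  ∑ (suc n) (λ k → ⟦ allB (λ x → x ≤ᵇ k) w ⟧ * ⟦ containsUpTo k w ⟧)
    ∎
  where
  M = maxL w
  others : ∀ k → k ≢ M → ⟦ allB (λ x → x ≤ᵇ k) w ⟧ * ⟦ containsUpTo k w ⟧ ≡ 0ℤ
  others k k≢M with ℕ.<-cmp k M
  ... | tri≈ _ k≡M _ = contradiction k≡M k≢M
  ... | tri< k<M _ _ with allB (λ x → x ≤ᵇ k) w in all≤k
  ...   | true  = contradiction (maxL≤ k w all≤k) (ℕ.<⇒≱ k<M)
  ...   | false = refl
  others (suc k) k≢M | tri> _ _ M<k with occurs (suc k) w in occ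
  ...   | true  = contradiction (occurs⇒≤maxL (suc k) w occ) (ℕ.<⇒≱ M<k)
  ...   | false = trans (cong (λ b → ⟦ allB (λ x → x ≤ᵇ suc k) w ⟧ * ⟦ b ⟧) (∧-zeroʳ (containsUpTo k w)))
                        (*-zeroʳ ⟦ allB (λ x → x ≤ᵇ suc k) w ⟧)

skip : ℕ → ℕ → ℕ
skip p v = if v ≤ᵇ p then v else suc v

skip-≤ : ∀ {p v} → v ℕ.≤ p → skip p v ≡ v
skip-≤ v≤p rewrite ≤ᵇ≡true v≤p = refl

skip-> : ∀ {p v} → p ℕ.< v → skip p v ≡ suc v
skip-> p<v rewrite ≤ᵇ≡false p<v = refl

skip-<ᵇ : ∀ p a b → (skip p a <ᵇ skip p b) ≡ (a <ᵇ b)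
skip-<ᵇ p a b with a ℕ.≤? p | b ℕ.≤? p
... | yes a≤p | yes b≤p rewrite skip-≤ a≤p | skip-≤ b≤p = refl
... | no a≰p  | no b≰p  rewrite skip-> (ℕ.≰⇒> a≰p) | skip-> (ℕ.≰⇒> b≰p) = refl
... | yes a≤p | no b≰p  rewrite skip-≤ a≤p | skip-> (ℕ.≰⇒> b≰p) =
  trans (<ᵇ≡true (ℕ.m<n⇒m<1+n a<b)) (sym (<ᵇ≡true a<b))
  where a<b = ℕ.≤-<-trans a≤p (ℕ.≰⇒> b≰p)
... | no a≰p  | yes b≤p rewrite skip-> (ℕ.≰⇒> a≰p) | skip-≤ b≤p =
  trans (<ᵇ≡false (ℕ.m≤n⇒m≤1+n b≤a)) (sym (<ᵇ≡false b≤a))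
  where b≤a = ℕ.≤-trans b≤p (ℕ.<⇒≤ (ℕ.≰⇒> a≰p))

des-map-skip : ∀ p w → des (map (skip p) w) ≡ des w
des-map-skip p []          = refl
des-map-skip p (x ∷ [])    = refl
des-map-skip p (x ∷ y ∷ w) = cong₂ (λ b d → (if b then 1 else 0) ℕ.+ d) (skip-<ᵇ p y x) (des-map-skip p (y ∷ w))

occurs-map-skip : ∀ {p x} w → x ℕ.≤ p → occurs x (map (skip p) w) ≡ occurs x w
occurs-map-skip []      x≤p = refl
occurs-map-skip {p} {x} (y ∷ w) x≤p = cong₂ _∨_ same-test (occurs-map-skip w x≤p)
  where
  same-test : (skip p y ≡ᵇ x) ≡ (y ≡ᵇ x)
  same-test with y ℕ.≤? p
  ... | yes y≤p rewrite skip-≤ y≤p = refl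
  ... | no y≰p  rewrite skip-> (ℕ.≰⇒> y≰p) =
    trans (≡ᵇ≡false (ℕ.>⇒≢ (s≤s (ℕ.≤-trans x≤p (ℕ.<⇒≤ (ℕ.≰⇒> y≰p))))))
          (sym (≡ᵇ≡false (ℕ.>⇒≢ (ℕ.≤-<-trans x≤p (ℕ.≰⇒> y≰p)))))

containsUpTo-map-skip : ∀ {p} q w → q ℕ.≤ p → containsUpTo q (map (skip p) w) ≡ containsUpTo q w
containsUpTo-map-skip zero    w _   = refl
containsUpTo-map-skip (suc q) w q<p =
  cong₂ _∧_ (containsUpTo-map-skip q w (ℕ.<⇒≤ q<p)) (occurs-map-skip w q<p)

not-occurs≡allB : ∀ v w → not (occurs v w) ≡ allB (λ x → not (x ≡ᵇ v)) w
not-occurs≡allB v []      = refl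
not-occurs≡allB v (x ∷ w) with x ≡ᵇ v
... | true  = refl
... | false = not-occurs≡allB v w

filterᵇ-all : ∀ (p : ℕ → Bool) {xs} → All (λ x → p x ≡ true) xs → filterᵇ p xs ≡ xs
filterᵇ-all p all = filter-all (T? ∘ p) (All.map (Equivalence.from T-≡) all)

filterᵇ-accept : ∀ (p : ℕ → Bool) {x} → p x ≡ true → filterᵇ p (x ∷ []) ≡ x ∷ []
filterᵇ-accept p px = filter-accept (T? ∘ p) (Equivalence.from T-≡ px)

filterᵇ-reject : ∀ (p : ℕ → Bool) {x} → p x ≡ false → filterᵇ p (x ∷ []) ≡ []
filterᵇ-reject p px = filter-reject (T? ∘ p) (subst T px)

filter-≤ᵇ-letters : ∀ {k n} → k ℕ.≤′ n → filterᵇ (λ x → x ≤ᵇ k) (letters n) ≡ letters k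
filter-≤ᵇ-letters {k} ℕ.≤′-refl = filterᵇ-all (λ x → x ≤ᵇ k) (All.map (≤ᵇ≡true ∘ proj₂) (letters-InRange k))
filter-≤ᵇ-letters {k} (ℕ.≤′-step {n} k≤′n) = begin
  filterᵇ ≤k (letters (suc n))
    ≡⟨ cong (filterᵇ ≤k) (letters-∷ʳ n) ⟩
  filterᵇ ≤k (letters n ++ suc n ∷ [])
    ≡⟨ filter-++ (T? ∘ ≤k) (letters n) (suc n ∷ []) ⟩
  filterᵇ ≤k (letters n) ++ filterᵇ ≤k (suc n ∷ [])
    ≡⟨ cong₂ _++_ (filter-≤ᵇ-letters k≤′n) (filterᵇ-reject ≤k (≤ᵇ≡false (s≤s (ℕ.≤′⇒≤ k≤′n)))) ⟩
  letters k ++ []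
    ≡⟨ ++-identityʳ (letters k) ⟩
  letters k
    ∎
  where ≤k = λ x → x ≤ᵇ k

filter-≢-letters : ∀ {p k} → p ℕ.≤′ k → filterᵇ (λ x → not (x ≡ᵇ suc p)) (letters (suc k)) ≡ map (skip p) (letters k)
filter-≢-letters {p} ℕ.≤′-refl = begin
  filterᵇ ≢p+1 (letters (suc p))
    ≡⟨ cong (filterᵇ ≢p+1) (letters-∷ʳ p) ⟩
  filterᵇ ≢p+1 (letters p ++ suc p ∷ [])
    ≡⟨ filter-++ (T? ∘ ≢p+1) (letters p) (suc p ∷ []) ⟩
  filterᵇ ≢p+1 (letters p) ++ filterᵇ ≢p+1 (suc p ∷ [])      ≡⟨ cong₂ _++_ (filterᵇ-all ≢p+1 (All.map below (letters-InRange p)))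
                                                                          (filterᵇ-reject ≢p+1 {suc p} (cong not (≡ᵇ-refl p))) ⟩
  letters p ++ []
    ≡⟨ ++-identityʳ (letters p) ⟩
  letters p
    ≡⟨ map-id-local (All.map (skip-≤ ∘ proj₂) (letters-InRange p)) ⟨
  map (skip p) (letters p)
    ∎
  where
  ≢p+1 = λ x → not (x ≡ᵇ suc p)
  below : ∀ {a} → InRange p a → not (a ≡ᵇ suc p) ≡ true
  below (_ , a≤p) = cong not (≡ᵇ≡false (ℕ.<⇒≢ (s≤s a≤p)))
filter-≢-letters {p} (ℕ.≤′-step {k} p≤′k) = begin
  filterᵇ ≢p+1 (letters (suc (suc k)))
    ≡⟨ cong (filterᵇ ≢p+1) (letters-∷ʳ (suc k)) ⟩
  filterᵇ ≢p+1 (letters (suc k) ++ suc (suc k) ∷ [])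
    ≡⟨ filter-++ (T? ∘ ≢p+1) (letters (suc k)) (suc (suc k) ∷ []) ⟩
  filterᵇ ≢p+1 (letters (suc k)) ++ filterᵇ ≢p+1 (suc (suc k) ∷ [])
    ≡⟨ cong₂ _++_ (filter-≢-letters p≤′k) (filterᵇ-accept ≢p+1 (cong not (≡ᵇ≡false (ℕ.>⇒≢ (s≤s p<k+1))))) ⟩
  map (skip p) (letters k) ++ suc (suc k) ∷ []
    ≡⟨ cong (λ x → map (skip p) (letters k) ++ x ∷ []) (skip-> p<k+1) ⟨
  map (skip p) (letters k) ++ map (skip p) (suc k ∷ [])
    ≡⟨ map-++ (skip p) (letters k) (suc k ∷ []) ⟨
  map (skip p) (letters k ++ suc k ∷ [])
    ≡⟨ cong (map (skip p)) (letters-∷ʳ k) ⟨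
  map (skip p) (letters (suc k))
    ∎
  where
  ≢p+1 = λ x → not (x ≡ᵇ suc p)
  p<k+1 = s≤s (ℕ.≤′⇒≤ p≤′k)

∑ₗ-wordsOver-allB : ∀ L m (p : ℕ → Bool) (G : List ℕ → ℤ) →
  ∑ₗ (wordsOver L m) (λ w → ⟦ allB p w ⟧ * G w) ≡ ∑ₗ (wordsOver (filterᵇ p L) m) G
∑ₗ-wordsOver-allB L zero    p G = cong (_+ 0ℤ) (*-identityˡ (G []))
∑ₗ-wordsOver-allB L (suc m) p G = begin
  ∑ₗ (wordsOver L (suc m)) (λ w → ⟦ allB p w ⟧ * G w)
    ≡⟨ ∑ₗ-wordsOver-suc L m _ ⟩
  ∑ₗ (wordsOver L m) (λ w → ∑ₗ L (λ a → ⟦ p a ∧ allB p w ⟧ * G (a ∷ w)))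
    ≡⟨ ∑ₗ-cong (wordsOver L m) (λ w → trans (∑ₗ-cong L (λ a → factor (p a) (allB p w) (G (a ∷ w)))) (∑ₗ-*ˡ L ⟦ allB p w ⟧ _)) ⟩
  ∑ₗ (wordsOver L m) (λ w → ⟦ allB p w ⟧ * ∑ₗ L (λ a → ⟦ p a ⟧ * G (a ∷ w)))
    ≡⟨ ∑ₗ-cong (wordsOver L m) (λ w → cong (⟦ allB p w ⟧ *_) (∑ₗ-filter (T? ∘ p) L (λ a → G (a ∷ w)))) ⟨
  ∑ₗ (wordsOver L m) (λ w → ⟦ allB p w ⟧ * ∑ₗ (filterᵇ p L) (λ a → G (a ∷ w)))
    ≡⟨ ∑ₗ-wordsOver-allB L m p _ ⟩
  ∑ₗ (wordsOver (filterᵇ p L) m) (λ w → ∑ₗ (filterᵇ p L) (λ a → G (a ∷ w)))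
    ≡⟨ ∑ₗ-wordsOver-suc (filterᵇ p L) m G ⟨
  ∑ₗ (wordsOver (filterᵇ p L) (suc m)) G
    ∎
  where
  factor : ∀ a b x → ⟦ a ∧ b ⟧ * x ≡ ⟦ b ⟧ * (⟦ a ⟧ * x)
  factor a b x = trans (cong (_* x) (⟦∧⟧ a b)) (swap ⟦ a ⟧ ⟦ b ⟧ x)
    where swap : ∀ a b x → a * b * x ≡ b * (a * x)
          swap = solve-∀

∑ₗ-wordsOver-map : ∀ (φ : ℕ → ℕ) L m (G : List ℕ → ℤ) → ∑ₗ (wordsOver (map φ L) m) G ≡ ∑ₗ (wordsOver L m) (G ∘ map φ)
∑ₗ-wordsOver-map φ L zero    G = refl
∑ₗ-wordsOver-map φ L (suc m) G = begin
  ∑ₗ (wordsOver (map φ L) (suc m)) G                                    ≡⟨ ∑ₗ-wordsOver-suc (map φ L) m G ⟩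
  ∑ₗ (wordsOver (map φ L) m) (λ w → ∑ₗ (map φ L) (λ a → G (a ∷ w)))    ≡⟨ ∑ₗ-wordsOver-map φ L m _ ⟩
  ∑ₗ (wordsOver L m) (λ w → ∑ₗ (map φ L) (λ a → G (a ∷ map φ w)))      ≡⟨ ∑ₗ-cong (wordsOver L m) (λ w → ∑ₗ-map φ L _) ⟩
  ∑ₗ (wordsOver L m) (λ w → ∑ₗ L (λ a → G (φ a ∷ map φ w)))            ≡⟨ ∑ₗ-wordsOver-suc L m (G ∘ map φ) ⟨
  ∑ₗ (wordsOver L (suc m)) (G ∘ map φ)                                  ∎

module InclusionExclusion (n : ℕ) (f : ℕ → ℤ) where

  F : List ℕ → ℤ
  F w = f (des w)

  sumContaining : ℕ → ℕ → ℤ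
  sumContaining k p = ∑ₗ (wordsOver (letters k) n) (λ w → ⟦ containsUpTo p w ⟧ * F w)

  -- Words over [k + 1] avoiding p + 1 are the images under skip p of the words over [k], and
  -- skip p preserves descents and the letters 1, …, p.
  sumAvoiding≡sumContaining : ∀ {p k} → p ℕ.≤′ k →
    ∑ₗ (wordsOver (letters (suc k)) n) (λ w → ⟦ not (occurs (suc p) w) ⟧ * (⟦ containsUpTo p w ⟧ * F w)) ≡ sumContaining k p
  sumAvoiding≡sumContaining {p} {k} p≤′k = begin
    ∑ₗ (wordsOver (letters (suc k)) n) (λ w → ⟦ not (occurs (suc p) w) ⟧ * G w)
      ≡⟨ ∑ₗ-cong (wordsOver (letters (suc k)) n) (λ w → cong (λ b → ⟦ b ⟧ * G w) (not-occurs≡allB (suc p) w)) ⟩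
    ∑ₗ (wordsOver (letters (suc k)) n) (λ w → ⟦ allB (λ x → not (x ≡ᵇ suc p)) w ⟧ * G w)
      ≡⟨ ∑ₗ-wordsOver-allB (letters (suc k)) n _ G ⟩
    ∑ₗ (wordsOver (filterᵇ (λ x → not (x ≡ᵇ suc p)) (letters (suc k))) n) G
      ≡⟨ cong (λ L → ∑ₗ (wordsOver L n) G) (filter-≢-letters p≤′k) ⟩
    ∑ₗ (wordsOver (map (skip p) (letters k)) n) G
      ≡⟨ ∑ₗ-wordsOver-map (skip p) (letters k) n G ⟩
    ∑ₗ (wordsOver (letters k) n) (G ∘ map (skip p))
      ≡⟨ ∑ₗ-cong (wordsOver (letters k) n) (λ w → cong₂ (λ b d → ⟦ b ⟧ * f d) (containsUpTo-map-skip p w ℕ.≤-refl) (des-map-skip p w)) ⟩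
    sumContaining k p
      ∎
    where
    G : List ℕ → ℤ
    G w = ⟦ containsUpTo p w ⟧ * F w

  sumContaining-suc : ∀ {p k} → p ℕ.≤′ k → sumContaining (suc k) p ≡ sumContaining (suc k) (suc p) + sumContaining k p
  sumContaining-suc {p} {k} p≤′k = begin
    sumContaining (suc k) p
      ≡⟨ ∑ₗ-cong (wordsOver (letters (suc k)) n) (λ w → split (containsUpTo p w) (occurs (suc p) w) (F w)) ⟩
    ∑ₗ (wordsOver (letters (suc k)) n) (λ w → ⟦ containsUpTo (suc p) w ⟧ * F w + ⟦ not (occurs (suc p) w) ⟧ * (⟦ containsUpTo p w ⟧ * F w))
      ≡⟨ ∑ₗ-+ (wordsOver (letters (suc k)) n) _ _ ⟩
    sumContaining (suc k) (suc p) + ∑ₗ (wordsOver (letters (suc k)) n) (λ w → ⟦ not (occurs (suc p) w) ⟧ * (⟦ containsUpTo p w ⟧ * F w))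
      ≡⟨ cong (λ s → sumContaining (suc k) (suc p) + s) (sumAvoiding≡sumContaining p≤′k) ⟩
    sumContaining (suc k) (suc p) + sumContaining k p
      ∎
    where
    split : ∀ c o x → ⟦ c ⟧ * x ≡ ⟦ c ∧ o ⟧ * x + ⟦ not o ⟧ * (⟦ c ⟧ * x)
    split true  true  x = split₁ x
      where split₁ : ∀ x → 1ℤ * x ≡ 1ℤ * x + 0ℤ * (1ℤ * x)
            split₁ = solve-∀
    split true  false x = split₂ x
      where split₂ : ∀ x → 1ℤ * x ≡ 0ℤ * x + 1ℤ * (1ℤ * x)
            split₂ = solve-∀
    split false true  x = refl
    split false false x = refl

  sumContaining≡alternating : ∀ p k → p ℕ.≤ k → sumContaining k p ≡ ∑ (suc p) (λ j → sgn j * C[ p , j ] * sumContaining (k ℕ.∸ j) 0)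
  sumContaining≡alternating zero    k       _         = sym (trans (+-identityˡ _) (*-identityˡ (sumContaining k 0)))
  sumContaining≡alternating (suc p) (suc k) (s≤s p≤k) = begin
    sumContaining (suc k) (suc p)
      ≡⟨ add-sub (sumContaining (suc k) (suc p)) (sumContaining k p) ⟩
    sumContaining (suc k) (suc p) + sumContaining k p - sumContaining k p
      ≡⟨ cong (_- sumContaining k p) (sumContaining-suc (ℕ.≤⇒≤′ p≤k)) ⟨
    sumContaining (suc k) p - sumContaining k p
      ≡⟨ cong₂ _-_ (sumContaining≡alternating p (suc k) (ℕ.m≤n⇒m≤1+n p≤k)) (sumContaining≡alternating p k p≤k) ⟩
    ∑ (suc p) (λ j → sgn j * C[ p , j ] * sumContaining (suc k ℕ.∸ j) 0) - ∑ (suc p) (λ j → sgn j * C[ p , j ] * sumContaining (k ℕ.∸ j) 0)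
      ≡⟨ alternating-pascal p (λ j → sumContaining (suc k ℕ.∸ j) 0) ⟨
    ∑ (suc (suc p)) (λ j → sgn j * C[ suc p , j ] * sumContaining (suc k ℕ.∸ j) 0)
      ∎
    where add-sub : ∀ a b → a ≡ a + b - b
          add-sub = solve-∀

∑ₗ-Cay : ∀ n (F : List ℕ → ℤ) → ∑ₗ (Cay n) F ≡ ∑ₗ (wordsOver (letters n) n) (λ w → ⟦ isCayley w ⟧ * F w)
∑ₗ-Cay n F = begin
  ∑ₗ (Cay n) F
    ≡⟨ ∑ₗ-filter (λ w → isCayley w ≟ᵇ true) (words n n) F ⟩
  ∑ₗ (words n n) (λ w → ⟦ does (isCayley w ≟ᵇ true) ⟧ * F w)
    ≡⟨ ∑ₗ-cong (words n n) (λ w → cong (_* F w) (⟦does≟true⟧ (isCayley w))) ⟩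
  ∑ₗ (words n n) (λ w → ⟦ isCayley w ⟧ * F w)
    ≡⟨ cong (λ W → ∑ₗ W (λ w → ⟦ isCayley w ⟧ * F w)) (words≡wordsOver-letters n n) ⟩
  ∑ₗ (wordsOver (letters n) n) (λ w → ⟦ isCayley w ⟧ * F w)
    ∎
  where
  ⟦does≟true⟧ : ∀ b → ⟦ does (b ≟ᵇ true) ⟧ ≡ ⟦ b ⟧
  ⟦does≟true⟧ true  = refl
  ⟦does≟true⟧ false = refl

∑ₗ-Cay-cong : ∀ n {F G : List ℕ → ℤ} → (∀ w → length w ≡ n → All (InRange n) w → F w ≡ G w) → ∑ₗ (Cay n) F ≡ ∑ₗ (Cay n) G
∑ₗ-Cay-cong n {F} {G} eq = begin
  ∑ₗ (Cay n) F
    ≡⟨ ∑ₗ-Cay n F ⟩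
  ∑ₗ (wordsOver (letters n) n) (λ w → ⟦ isCayley w ⟧ * F w)
    ≡⟨ ∑ₗ-wordsOver-cong n (letters-InRange n) (λ w len ws → cong (⟦ isCayley w ⟧ *_) (eq w len ws)) ⟩
  ∑ₗ (wordsOver (letters n) n) (λ w → ⟦ isCayley w ⟧ * G w)
    ≡⟨ ∑ₗ-Cay n G ⟨
  ∑ₗ (Cay n) G
    ∎

∑ₗ-Cay-alternating : ∀ n (f : ℕ → ℤ) →
  ∑ₗ (Cay n) (f ∘ des) ≡ ∑ (suc n) (λ k → ∑ (suc k) (λ j → sgn j * C[ k , j ] * ∑ₗ (wordsOver (letters (k ℕ.∸ j)) n) (f ∘ des)))
∑ₗ-Cay-alternating n f = begin
  ∑ₗ (Cay n) F
    ≡⟨ ∑ₗ-Cay n F ⟩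
  ∑ₗ W (λ w → ⟦ isCayley w ⟧ * F w)
    ≡⟨ ∑ₗ-wordsOver-cong n (letters-InRange n) (λ w _ ws → trans (cong (_* F w) (⟦isCayley⟧≡∑ n w ws)) (sym (∑-*ʳ (suc n) (F w) _))) ⟩
  ∑ₗ W (λ w → ∑ (suc n) (λ k → ⟦ allB (λ x → x ≤ᵇ k) w ⟧ * ⟦ containsUpTo k w ⟧ * F w))
    ≡⟨ ∑ₗ-∑ W (suc n) _ ⟩
  ∑ (suc n) (λ k → ∑ₗ W (λ w → ⟦ allB (λ x → x ≤ᵇ k) w ⟧ * ⟦ containsUpTo k w ⟧ * F w))
    ≡⟨ ∑-cong-< (suc n) (λ k k<1+n → restrict k (ℕ.≤⇒≤′ (ℕ.≤-pred k<1+n))) ⟩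
  ∑ (suc n) (λ k → sumContaining k k)
    ≡⟨ ∑-cong (suc n) (λ k → sumContaining≡alternating k k ℕ.≤-refl) ⟩
  ∑ (suc n) (λ k → ∑ (suc k) (λ j → sgn j * C[ k , j ] * sumContaining (k ℕ.∸ j) 0))
    ≡⟨ ∑-cong (suc n) (λ k → ∑-cong (suc k) (λ j → cong (sgn j * C[ k , j ] *_)
                                                        (∑ₗ-cong (wordsOver (letters (k ℕ.∸ j)) n) (λ w → *-identityˡ (F w))))) ⟩
  ∑ (suc n) (λ k → ∑ (suc k) (λ j → sgn j * C[ k , j ] * ∑ₗ (wordsOver (letters (k ℕ.∸ j)) n) F))
    ∎
  where
  open InclusionExclusion n f
  W = wordsOver (letters n) n
  restrict : ∀ k → k ℕ.≤′ n → ∑ₗ W (λ w → ⟦ allB (λ x → x ≤ᵇ k) w ⟧ * ⟦ containsUpTo k w ⟧ * F w) ≡ sumContaining k k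
  restrict k k≤′n = begin
    ∑ₗ W (λ w → ⟦ allB (λ x → x ≤ᵇ k) w ⟧ * ⟦ containsUpTo k w ⟧ * F w)
      ≡⟨ ∑ₗ-cong W (λ w → *-assoc ⟦ allB (λ x → x ≤ᵇ k) w ⟧ ⟦ containsUpTo k w ⟧ (F w)) ⟩
    ∑ₗ W (λ w → ⟦ allB (λ x → x ≤ᵇ k) w ⟧ * (⟦ containsUpTo k w ⟧ * F w))
      ≡⟨ ∑ₗ-wordsOver-allB (letters n) n (λ x → x ≤ᵇ k) _ ⟩
    ∑ₗ (wordsOver (filterᵇ (λ x → x ≤ᵇ k) (letters n)) n) (λ w → ⟦ containsUpTo k w ⟧ * F w)
      ≡⟨ cong (λ L → ∑ₗ (wordsOver L n) (λ w → ⟦ containsUpTo k w ⟧ * F w)) (filter-≤ᵇ-letters k≤′n) ⟩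
    sumContaining k k
      ∎

coeff-Ccirc : ∀ n j → coeff (Ccirc n) j ≡ ∑ₗ (Cay n) (λ w → coeff (tpow (des w)) j)
coeff-Ccirc n j = coeff-foldr (Cay n)
  where
  coeff-foldr : ∀ L → coeff (foldr (λ w acc → tpow (des w) ⊕ acc) [] L) j ≡ ∑ₗ L (λ w → coeff (tpow (des w)) j)
  coeff-foldr []      = refl
  coeff-foldr (w ∷ L) = trans (coeff-⊕ (tpow (des w)) _ j) (cong (λ s → coeff (tpow (des w)) j + s) (coeff-foldr L))

descentsChoose : ℕ → ℕ → ℤ
descentsChoose n e = ∑ₗ (Cay n) (λ w → C[ des w , e ])

rhsCoefficient : ℕ → ℕ → ℤ
rhsCoefficient n i = ∑ (suc n) (λ k → s₁ n k * + fub k * surj k i)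

lhs-expansion : ∀ n j → + (n !) * coeff (Ccirc n) j ≡
  ∑ (suc n) (λ i → + (n !) * descentsChoose n (n ℕ.∸ i) * coeff[t-1]^ (n ℕ.∸ i) j)
lhs-expansion n j = begin
  + (n !) * coeff (Ccirc n) j
    ≡⟨ cong (+ (n !) *_) (trans (coeff-Ccirc n j) (∑ₗ-Cay-cong n (λ w len _ → expand w len))) ⟩
  + (n !) * ∑ₗ (Cay n) (λ w → ∑ (suc n) (λ e → C[ des w , e ] * coeff[t-1]^ e j))
    ≡⟨ cong (+ (n !) *_) (trans (∑ₗ-∑ (Cay n) (suc n) _) (∑-cong (suc n) (λ e → ∑ₗ-*ʳ (Cay n) (coeff[t-1]^ e j) _))) ⟩
  + (n !) * ∑ (suc n) (λ e → descentsChoose n e * coeff[t-1]^ e j)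
    ≡⟨ ∑-*ˡ (suc n) (+ (n !)) _ ⟨
  ∑ (suc n) (λ e → + (n !) * (descentsChoose n e * coeff[t-1]^ e j))
    ≡⟨ ∑-reverse (suc n) _ ⟨
  ∑ (suc n) (λ i → + (n !) * (descentsChoose n (n ℕ.∸ i) * coeff[t-1]^ (n ℕ.∸ i) j))
    ≡⟨ ∑-cong (suc n) (λ i → sym (*-assoc (+ (n !)) _ _)) ⟩
  ∑ (suc n) (λ i → + (n !) * descentsChoose n (n ℕ.∸ i) * coeff[t-1]^ (n ℕ.∸ i) j)
    ∎
  where
  expand : ∀ w → length w ≡ n → coeff (tpow (des w)) j ≡ ∑ (suc n) (λ e → C[ des w , e ] * coeff[t-1]^ e j)
  expand w refl = trans (coeff-tpow (des w) j)
    (sym (∑-extend (suc (des w)) (suc (length w)) (s≤s (des≤length w)) (λ e des<e → cong (_* coeff[t-1]^ e j) (C-vanish des<e))))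

rhs-expansion : ∀ n j → coeff (rhsTimesFact n) j ≡ ∑ (suc n) (λ i → rhsCoefficient n i * coeff[t-1]^ (n ℕ.∸ i) j)
rhs-expansion n j = begin
  coeff (rhsTimesFact n) j
    ≡⟨ coeff-ΣP n _ j ⟩
  ∑ (suc n) (λ k → coeff (scale (sgn (n ℕ.∸ k) * + (stirling1 n k ℕ.* fub k)) (ΣP k (λ i → scale (surj k i) (tMinus1 ^ₚ (n ℕ.∸ i))))) j)
    ≡⟨ ∑-cong-< (suc n) (λ k k<1+n → summand k (ℕ.≤-pred k<1+n)) ⟩
  ∑ (suc n) (λ k → ∑ (suc n) (λ i → s₁ n k * + fub k * surj k i * τ i))
    ≡⟨ ∑-swap (suc n) (suc n) _ ⟩
  ∑ (suc n) (λ i → ∑ (suc n) (λ k → s₁ n k * + fub k * surj k i * τ i))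
    ≡⟨ ∑-cong (suc n) (λ i → ∑-*ʳ (suc n) (τ i) (λ k → s₁ n k * + fub k * surj k i)) ⟩
  ∑ (suc n) (λ i → rhsCoefficient n i * τ i)
    ∎
  where
  τ : ℕ → ℤ
  τ i = coeff[t-1]^ (n ℕ.∸ i) j
  weight : ∀ k → sgn (n ℕ.∸ k) * + (stirling1 n k ℕ.* fub k) ≡ s₁ n k * + fub k
  weight k = trans (cong (sgn (n ℕ.∸ k) *_) (pos-* (stirling1 n k) (fub k))) (sym (*-assoc (sgn (n ℕ.∸ k)) _ _))
  summand : ∀ k → k ℕ.≤ n →
    coeff (scale (sgn (n ℕ.∸ k) * + (stirling1 n k ℕ.* fub k)) (ΣP k (λ i → scale (surj k i) (tMinus1 ^ₚ (n ℕ.∸ i))))) j ≡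
    ∑ (suc n) (λ i → s₁ n k * + fub k * surj k i * τ i)
  summand k k≤n = begin
    coeff (scale (sgn (n ℕ.∸ k) * + (stirling1 n k ℕ.* fub k)) (ΣP k (λ i → scale (surj k i) (tMinus1 ^ₚ (n ℕ.∸ i))))) j
      ≡⟨ coeff-scale (sgn (n ℕ.∸ k) * + (stirling1 n k ℕ.* fub k)) (ΣP k (λ i → scale (surj k i) (tMinus1 ^ₚ (n ℕ.∸ i)))) j ⟩
    (sgn (n ℕ.∸ k) * + (stirling1 n k ℕ.* fub k)) * coeff (ΣP k (λ i → scale (surj k i) (tMinus1 ^ₚ (n ℕ.∸ i)))) j
      ≡⟨ cong₂ _*_ (weight k) (trans (coeff-ΣP k _ j) (∑-cong (suc k) (λ i → coeff-scale (surj k i) (tMinus1 ^ₚ (n ℕ.∸ i)) j))) ⟩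
    s₁ n k * + fub k * ∑ (suc k) (λ i → surj k i * τ i)
      ≡⟨ cong (s₁ n k * + fub k *_) (∑-extend (suc k) (suc n) (s≤s k≤n) (λ i k<i → cong (_* τ i) (surj-vanish k<i))) ⟨
    s₁ n k * + fub k * ∑ (suc n) (λ i → surj k i * τ i)
      ≡⟨ ∑-*ˡ (suc n) (s₁ n k * + fub k) _ ⟨
    ∑ (suc n) (λ i → s₁ n k * + fub k * (surj k i * τ i))
      ≡⟨ ∑-cong (suc n) (λ i → sym (*-assoc (s₁ n k * + fub k) (surj k i) (τ i))) ⟩
    ∑ (suc n) (λ i → s₁ n k * + fub k * surj k i * τ i)
      ∎

binomialTransform-descentsChoose : ∀ n r →
  ∑ (suc n) (λ i → C[ r , i ] * (+ (n !) * descentsChoose n (n ℕ.∸ i))) ≡ stirlingFubini n r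
binomialTransform-descentsChoose n r = begin
  ∑ (suc n) (λ i → C[ r , i ] * (+ (n !) * descentsChoose n (n ℕ.∸ i)))
    ≡⟨ ∑-cong (suc n) (λ i → swap C[ r , i ] (+ (n !)) (descentsChoose n (n ℕ.∸ i))) ⟩
  ∑ (suc n) (λ i → + (n !) * (C[ r , i ] * descentsChoose n (n ℕ.∸ i)))
    ≡⟨ ∑-*ˡ (suc n) (+ (n !)) _ ⟩
  + (n !) * ∑ (suc n) (λ i → C[ r , i ] * descentsChoose n (n ℕ.∸ i))
    ≡⟨ cong (+ (n !) *_) (trans (∑-cong (suc n) (λ i → sym (∑ₗ-*ˡ (Cay n) C[ r , i ] _))) (sym (∑ₗ-∑ (Cay n) (suc n) _))) ⟩
  + (n !) * ∑ₗ (Cay n) (λ w → ∑ (suc n) (λ i → C[ r , i ] * C[ des w , n ℕ.∸ i ]))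
    ≡⟨ cong (+ (n !) *_) (∑ₗ-cong (Cay n) (λ w → C-vandermonde r (des w) n)) ⟩
  + (n !) * ∑ₗ (Cay n) (λ w → C[ r ℕ.+ des w , n ])
    ≡⟨ cong (+ (n !) *_) (∑ₗ-Cay-alternating n (λ d → C[ r ℕ.+ d , n ])) ⟩
  + (n !) * ∑ (suc n) (λ k → ∑ (suc k) (λ j → sgn j * C[ k , j ] * ∑ₗ (wordsOver (letters (k ℕ.∸ j)) n) (λ w → C[ r ℕ.+ des w , n ])))
    ≡⟨ cong (+ (n !) *_) (∑-cong (suc n) (λ k → ∑-cong (suc k) (λ j → cong (sgn j * C[ k , j ] *_) (∑-words-C-des (k ℕ.∸ j) n r)))) ⟩
  + (n !) * ∑ (suc n) (λ k → ∑ (suc k) (λ j → sgn j * C[ k , j ] * C[ r ℕ.* (k ℕ.∸ j) , n ]))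
    ≡⟨ fubini-expansion n r ⟩
  stirlingFubini n r
    ∎
  where swap : ∀ x y z → x * (y * z) ≡ y * (x * z)
        swap = solve-∀

binomialTransform-rhsCoefficient : ∀ n r →
  ∑ (suc n) (λ i → C[ r , i ] * rhsCoefficient n i) ≡ stirlingFubini n r
binomialTransform-rhsCoefficient n r = begin
  ∑ (suc n) (λ i → C[ r , i ] * ∑ (suc n) (λ k → a k * surj k i))
    ≡⟨ ∑-cong (suc n) (λ i → sym (∑-*ˡ (suc n) C[ r , i ] _)) ⟩
  ∑ (suc n) (λ i → ∑ (suc n) (λ k → C[ r , i ] * (a k * surj k i)))
    ≡⟨ ∑-swap (suc n) (suc n) _ ⟩
  ∑ (suc n) (λ k → ∑ (suc n) (λ i → C[ r , i ] * (a k * surj k i)))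
    ≡⟨ ∑-cong-< (suc n) (λ k k<1+n → power k k<1+n) ⟩
  ∑ (suc n) (λ k → a k * (+ r) ^ k)
    ∎
  where
  a : ℕ → ℤ
  a k = s₁ n k * + fub k
  swap : ∀ x y z → x * (y * z) ≡ y * (x * z)
  swap = solve-∀
  power : ∀ k → k ℕ.< suc n → ∑ (suc n) (λ i → C[ r , i ] * (a k * surj k i)) ≡ a k * (+ r) ^ k
  power k k<1+n = begin
    ∑ (suc n) (λ i → C[ r , i ] * (a k * surj k i))   ≡⟨ ∑-cong (suc n) (λ i → swap C[ r , i ] (a k) (surj k i)) ⟩
    ∑ (suc n) (λ i → a k * (C[ r , i ] * surj k i))   ≡⟨ ∑-*ˡ (suc n) (a k) _ ⟩
    a k * ∑ (suc n) (λ i → C[ r , i ] * surj k i)     ≡⟨ cong (a k *_) (∑-extend (suc k) (suc n) k<1+n vanish) ⟩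
    a k * ∑ (suc k) (λ i → C[ r , i ] * surj k i)     ≡⟨ cong (a k *_) (pow≡∑surj r k) ⟨
    a k * (+ r) ^ k                                   ∎
    where vanish : ∀ i → suc k ℕ.≤ i → C[ r , i ] * surj k i ≡ 0ℤ
          vanish i k<i = trans (cong (C[ r , i ] *_) (surj-vanish k<i)) (*-zeroʳ C[ r , i ])

mainTheorem13 : (n : ℕ) → (j : ℕ) →
    (+ (n !)) * coeff (Ccirc n) j ≡ coeff (rhsTimesFact n) j
mainTheorem13 n j = begin
  + (n !) * coeff (Ccirc n) j
    ≡⟨ lhs-expansion n j ⟩
  ∑ (suc n) (λ i → + (n !) * descentsChoose n (n ℕ.∸ i) * coeff[t-1]^ (n ℕ.∸ i) j)
    ≡⟨ ∑-cong-< (suc n) (λ i i<1+n → cong (_* coeff[t-1]^ (n ℕ.∸ i) j) (same-transform i (ℕ.≤-pred i<1+n))) ⟩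
  ∑ (suc n) (λ i → rhsCoefficient n i * coeff[t-1]^ (n ℕ.∸ i) j)
    ≡⟨ rhs-expansion n j ⟨
  coeff (rhsTimesFact n) j
    ∎
  where
  same-transform : ∀ i → i ℕ.≤ n → + (n !) * descentsChoose n (n ℕ.∸ i) ≡ rhsCoefficient n i
  same-transform = binomial-transform-injective n (λ i → + (n !) * descentsChoose n (n ℕ.∸ i)) (rhsCoefficient n)
    (λ r → trans (binomialTransform-descentsChoose n r) (sym (binomialTransform-rhsCoefficient n r)))
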